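{- In the setting below, for every $i=1,2,\dots,9$, $$[\Psi^{ -\{ed,fc,e\}}_{ab}(F\mid f)]_{[i]}=M[i,8]\cdot\Psi(K\mid d).$$ (That is, the maximal matchings counted contain neither $ed$ nor $fc$, cover $f$, and leave $e$ uncovered.)
   Context: A matching is maximal if it is not contained in a larger matching; $\Psi(X)$ is the number of maximal matchings of a graph $X$ (the empty graph has one). For a graph $X$ and collections $A,B$ of vertices and edges of $X$, $\Psi^{ -A}(X\mid B)$ is the number of maximal matchings of $X$ that cover every vertex in $B$, contain every edge in $B$, leave every vertex in $A$ uncovered and contain no edge in $A$ (omitted $A$ or $B$ means no such constraint). $X-v$ deletes a vertex, $X-uv$ deletes an edge; $\Psi(X-v)$ counts maximal matchings of the subgraph $X-v$. For an edge $xy$ of $X$, $\Psi^{ -A}_{xy}(X\mid B)=(\Psi^{ -A}(X\mid B),\Psi^{ -A}(X-x\mid B),\Psi^{ -A}(X-y\mid B),\Psi^{ -A}(X-x-y\mid B),\Psi^{ -A}(X\mid x,y,B),\Psi^{ -A}(X-x\mid y,B),\Psi^{ -A}(X-y\mid x,B),\Psi^{ -A}(X\mid x,B),\Psi^{ -A}(X\mid y,B))^T$; $[v]_{[i]}$ is its $i$-th component and $M[i,j]$ the $(i,j)$ entry of $M$. Setting. $H$ is a hexagonal ring: a 2-connected plane graph with hexagons $H_1,\dots,H_n$ arranged cyclically, $H_{i-1},H_i$ sharing exactly one edge $e_i$ ($i=2,\dots,n$), $H_n,H_1$ sharing exactly one edge $e_1$, no other pairs sharing edges, each vertex on at most two hexagons.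 With a fixed planar embedding, $k_i\in\{1,2,3\}$ is the number of edges of $H_i$ strictly between $e_i$ and $e_{i+1}$ when $H_i$ is traversed clockwise from $e_i$ (indices mod $n$), $M_i=t(k_i)$, $f(t(1))=L$, $f(t(2))=S$, $f(t(3))=R$, and $M=f(M_1)f(M_2)\cdots f(M_n)$, where $S=\begin{pmatrix}1&1&1&1&1&1&1&0&0\\0&1&0&1&0&0&1&1&0\\0&0&1&1&0&1&0&0&1\\0&0&0&1&1&1&1&0&0\\1&0&0&1&1&1&1&0&0\\0&1&0&0&0&0&0&1&0\\0&0&1&0&0&0&0&0&1\\1&0&1&1&1&1&1&0&0\\1&1&0&1&1&1&1&0&0\end{pmatrix}$, $L=\begin{pmatrix}1&1&1&1&1&1&1&0&0\\1&0&1&0&0&0&0&0&1\\0&1&0&1&0&0&1&1&0\\1&0&1&0&0&0&0&0&0\\1&0&1&1&0&1&0&0&0\\0&0&1&0&0&0&0&0&1\\0&1&0&1&0&0&0&0&0\\1&1&1&1&0&1&0&0&0\\1&0&1&1&1&1&1&0&0\end{pmatrix}$, $R=\begin{pmatrix}1&1&1&1&1&1&1&0&0\\0&0&1&1&0&1&0&0&1\\1&1&0&0&0&0&0&1&0\\1&1&0&0&0&0&0&0&0\\1&1&0&1&0&0&1&0&0\\0&0&1&1&0&0&0&0&0\\0&1&0&0&0&0&0&1&0\\1&1&0&1&1&1&1&0&0\\1&1&1&1&0&0&1&0&0\end{pmatrix}$. Write $e_1=dc$, where $d$ precedes $c$ when $H_n$ is traversed clockwise; $e$ is the neighbour of $d$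 on $H_n$ other than $c$, and $f$ is the neighbour of $c$ on $H_n$ other than $d$. $G$ is the hexagonal chain obtained by cutting $H$ along $dc$: $d,c$ and the edge $dc$ stay with $H_n$, while on $H_1$ they are replaced by new vertices $a$ (copy of $d$) and $b$ (copy of $c$) joined by the edge $ab$, the edges of $H_1$ formerly incident to $d$ (resp. $c$) becoming incident to $a$ (resp. $b$). $K$ is an arbitrary graph containing the edge $dc$ with $V(K)\cap V(G)=\{d,c\}$ and $E(K)\cap E(G)=\{dc\}$, and $F=G\cup K$. -}

module Defs where

open import Data.Nat using (ℕ; zero; suc; _+_; _*_; _∸_)
open import Data.Fin using (Fin; zero; suc; fromℕ; inject₁)
import Data.Fin.Properties as FinP
open import Data.Bool using (Bool; true; false; _∧_; _∨_; not; if_then_else_)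
import Data.Vec as Vec
open import Data.Vec using (Vec; []; _∷_)
open import Data.List.Base using (List; []; _∷_; _++_; map; take; drop; allFin; concatMap)
open import Data.List.Relation.Unary.All using (All)
open import Data.List.Relation.Unary.AllPairs using (AllPairs)
open import Data.Product using (_×_; _,_)
open import Data.Sum using (_⊎_; inj₁; inj₂)
import Data.Sum.Properties as SumP
open import Relation.Nullary using (¬_; yes; no; does)
open import Relation.Binary.Definitions using (DecidableEquality)
open import Relation.Binary.PropositionalEquality using (_≡_; _≢_; refl; cong)

-- Isolated vertices play no role for
-- matchings, so a graph is identified with its edge list.

Edge : Set → Set
Edge V = V × V

_≈ₑ_ : {V : Set} → Edge V → Edge V → Set
(u , v) ≈ₑ (x , y) = (u ≡ x × v ≡ y) ⊎ (u ≡ y × v ≡ x)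

SimpleEdges : {V : Set} → List (Edge V) → Set
SimpleEdges E = All (λ { (u , v) → u ≢ v }) E × AllPairs (λ e e' → ¬ (e ≈ₑ e')) E

allᵇ anyᵇ : {A : Set} → (A → Bool) → List A → Bool
allᵇ P [] = true
allᵇ P (x ∷ xs) = P x ∧ allᵇ P xs
anyᵇ P [] = false
anyᵇ P (x ∷ xs) = P x ∨ anyᵇ P xs

sublists : {A : Set} → List A → List (List A)
sublists [] = [] ∷ []
sublists (x ∷ xs) = let r = sublists xs in r ++ map (x ∷_) r

count : {A : Set} → (A → Bool) → List A → ℕ
count P [] = 0
count P (x ∷ xs) = if P x then suc (count P xs) else count P xs

-- constraints of Ψ^{-A}(X | B): A = avoidV ∪ avoidE, B = coverV ∪ containE
record Constraints (V : Set) : Set where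
  constructor cons
  field
    avoidV   : List V
    avoidE   : List (Edge V)
    coverV   : List V
    containE : List (Edge V)
open Constraints public

noConstraints : {V : Set} → Constraints V
noConstraints = cons [] [] [] []

addCover : {V : Set} → List V → Constraints V → Constraints V
addCover xs (cons a b c d) = cons a b (xs ++ c) d

module Matching {V : Set} (_≟_ : DecidableEquality V) where

  _==_ : V → V → Bool
  x == y = does (x ≟ y)

  sameEdge : Edge V → Edge V → Bool
  sameEdge (u , v) (x , y) = ((u == x) ∧ (v == y)) ∨ ((u == y) ∧ (v == x))

  memE : Edge V → List (Edge V) → Bool
  memE e S = anyᵇ (sameEdge e) S

  incident : V → Edge V → Bool
  incident w (u , v) = (u == w) ∨ (v == w)

  covers : List (Edge V) → V → Bool
  covers S w = anyᵇ (incident w) S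

  shareVertex : Edge V → Edge V → Bool
  shareVertex (u , v) e' = incident u e' ∨ incident v e'

  isMatching : List (Edge V) → Bool
  isMatching [] = true
  isMatching (e ∷ S) = not (anyᵇ (shareVertex e) S) ∧ isMatching S

  isMaximal : List (Edge V) → List (Edge V) → Bool
  isMaximal E S = allᵇ (λ e → memE e S ∨ not (isMatching (e ∷ S))) E

  ok : Constraints V → List (Edge V) → List (Edge V) → Bool
  ok C E S = isMatching S ∧ isMaximal E S
           ∧ allᵇ (λ w → not (covers S w)) (avoidV C)
           ∧ allᵇ (λ e → not (memE e S)) (avoidE C)
           ∧ allᵇ (covers S) (coverV C)
           ∧ allᵇ (λ e → memE e S) (containE C)

  Ψ : Constraints V → List (Edge V) → ℕ
  Ψ C E = count (ok C E) (sublists E)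

  delV : V → List (Edge V) → List (Edge V)
  delV w [] = []
  delV w (e ∷ E) = if incident w e then delV w E else e ∷ delV w E

  union : List (Edge V) → List (Edge V) → List (Edge V)
  union E₁ E₂ = E₁ ++ dedup E₂
    where
    dedup : List (Edge V) → List (Edge V)
    dedup [] = []
    dedup (e ∷ E) = if memE e E₁ then dedup E else e ∷ dedup E

  Ψvec : Constraints V → List (Edge V) → V → V → Fin 9 → ℕ
  Ψvec C E x y zero = Ψ C E
  Ψvec C E x y (suc zero) = Ψ C (delV x E)
  Ψvec C E x y (suc (suc zero)) = Ψ C (delV y E)
  Ψvec C E x y (suc (suc (suc zero))) = Ψ C (delV y (delV x E))
  Ψvec C E x y (suc (suc (suc (suc zero)))) = Ψ (addCover (x ∷ y ∷ []) C) E
  Ψvec C E x y (suc (suc (suc (suc (suc zero))))) = Ψ (addCover (y ∷ []) C) (delV x E)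
  Ψvec C E x y (suc (suc (suc (suc (suc (suc zero)))))) = Ψ (addCover (x ∷ []) C) (delV y E)
  Ψvec C E x y (suc (suc (suc (suc (suc (suc (suc zero))))))) = Ψ (addCover (x ∷ []) C) E
  Ψvec C E x y (suc (suc (suc (suc (suc (suc (suc (suc zero)))))))) = Ψ (addCover (y ∷ []) C) E

mapEdge : {A B : Set} → (A → B) → Edge A → Edge B
mapEdge g (u , v) = g u , g v

Mat : Set
Mat = Fin 9 → Fin 9 → ℕ

sumFin : (n : ℕ) → (Fin n → ℕ) → ℕ
sumFin zero f = 0
sumFin (suc n) f = f zero + sumFin n (λ i → f (suc i))

_⊗_ : Mat → Mat → Mat
(A ⊗ B) i j = sumFin 9 (λ l → A i l * B l j)

I9 : Mat
I9 i j = if does (i FinP.≟ j) then 1 else 0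

Sₘ : Mat
Sₘ i j = Vec.lookup (Vec.lookup rows i) j
  where
  rows : Vec (Vec ℕ 9) 9
  rows = (1 ∷ 1 ∷ 1 ∷ 1 ∷ 1 ∷ 1 ∷ 1 ∷ 0 ∷ 0 ∷ []) ∷ (0 ∷ 1 ∷ 0 ∷ 1 ∷ 0 ∷ 0 ∷ 1 ∷ 1 ∷ 0 ∷ []) ∷ (0 ∷ 0 ∷ 1 ∷ 1 ∷ 0 ∷ 1 ∷ 0 ∷ 0 ∷ 1 ∷ []) ∷ (0 ∷ 0 ∷ 0 ∷ 1 ∷ 1 ∷ 1 ∷ 1 ∷ 0 ∷ 0 ∷ []) ∷ (1 ∷ 0 ∷ 0 ∷ 1 ∷ 1 ∷ 1 ∷ 1 ∷ 0 ∷ 0 ∷ []) ∷ (0 ∷ 1 ∷ 0 ∷ 0 ∷ 0 ∷ 0 ∷ 0 ∷ 1 ∷ 0 ∷ []) ∷ (0 ∷ 0 ∷ 1 ∷ 0 ∷ 0 ∷ 0 ∷ 0 ∷ 0 ∷ 1 ∷ []) ∷ (1 ∷ 0 ∷ 1 ∷ 1 ∷ 1 ∷ 1 ∷ 1 ∷ 0 ∷ 0 ∷ []) ∷ (1 ∷ 1 ∷ 0 ∷ 1 ∷ 1 ∷ 1 ∷ 1 ∷ 0 ∷ 0 ∷ []) ∷ []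

Lₘ : Mat
Lₘ i j = Vec.lookup (Vec.lookup rows i) j
  where
  rows : Vec (Vec ℕ 9) 9
  rows = (1 ∷ 1 ∷ 1 ∷ 1 ∷ 1 ∷ 1 ∷ 1 ∷ 0 ∷ 0 ∷ []) ∷ (1 ∷ 0 ∷ 1 ∷ 0 ∷ 0 ∷ 0 ∷ 0 ∷ 0 ∷ 1 ∷ []) ∷ (0 ∷ 1 ∷ 0 ∷ 1 ∷ 0 ∷ 0 ∷ 1 ∷ 1 ∷ 0 ∷ []) ∷ (1 ∷ 0 ∷ 1 ∷ 0 ∷ 0 ∷ 0 ∷ 0 ∷ 0 ∷ 0 ∷ []) ∷ (1 ∷ 0 ∷ 1 ∷ 1 ∷ 0 ∷ 1 ∷ 0 ∷ 0 ∷ 0 ∷ []) ∷ (0 ∷ 0 ∷ 1 ∷ 0 ∷ 0 ∷ 0 ∷ 0 ∷ 0 ∷ 1 ∷ []) ∷ (0 ∷ 1 ∷ 0 ∷ 1 ∷ 0 ∷ 0 ∷ 0 ∷ 0 ∷ 0 ∷ []) ∷ (1 ∷ 1 ∷ 1 ∷ 1 ∷ 0 ∷ 1 ∷ 0 ∷ 0 ∷ 0 ∷ []) ∷ (1 ∷ 0 ∷ 1 ∷ 1 ∷ 1 ∷ 1 ∷ 1 ∷ 0 ∷ 0 ∷ []) ∷ []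

Rₘ : Mat
Rₘ i j = Vec.lookup (Vec.lookup rows i) j
  where
  rows : Vec (Vec ℕ 9) 9
  rows = (1 ∷ 1 ∷ 1 ∷ 1 ∷ 1 ∷ 1 ∷ 1 ∷ 0 ∷ 0 ∷ []) ∷ (0 ∷ 0 ∷ 1 ∷ 1 ∷ 0 ∷ 1 ∷ 0 ∷ 0 ∷ 1 ∷ []) ∷ (1 ∷ 1 ∷ 0 ∷ 0 ∷ 0 ∷ 0 ∷ 0 ∷ 1 ∷ 0 ∷ []) ∷ (1 ∷ 1 ∷ 0 ∷ 0 ∷ 0 ∷ 0 ∷ 0 ∷ 0 ∷ 0 ∷ []) ∷ (1 ∷ 1 ∷ 0 ∷ 1 ∷ 0 ∷ 0 ∷ 1 ∷ 0 ∷ 0 ∷ []) ∷ (0 ∷ 0 ∷ 1 ∷ 1 ∷ 0 ∷ 0 ∷ 0 ∷ 0 ∷ 0 ∷ []) ∷ (0 ∷ 1 ∷ 0 ∷ 0 ∷ 0 ∷ 0 ∷ 0 ∷ 1 ∷ 0 ∷ []) ∷ (1 ∷ 1 ∷ 0 ∷ 1 ∷ 1 ∷ 1 ∷ 1 ∷ 0 ∷ 0 ∷ []) ∷ (1 ∷ 1 ∷ 1 ∷ 1 ∷ 0 ∷ 0 ∷ 1 ∷ 0 ∷ 0 ∷ []) ∷ []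

-- f(t(k)) : k = 1 ↦ L, k = 2 ↦ S, k = 3 ↦ R (other values never used)
kMat : ℕ → Mat
kMat 1 = Lₘ
kMat 2 = Sₘ
kMat 3 = Rₘ
kMat _ = I9

prodMats : (n : ℕ) → (Fin n → Mat) → Mat
prodMats zero A = I9
prodMats (suc n) A = A zero ⊗ prodMats n (λ i → A (suc i))

-- M = f(M_1) f(M_2) ... f(M_n)  (hexagon H_{i+1} has index i : Fin n)
ringMatrix : (n : ℕ) → (Fin n → ℕ) → Mat
ringMatrix n k = prodMats n (λ i → kMat (k i))

-- The hexagonal chain G obtained by cutting the ring along e_1 = dc.
-- Index j : Fin (suc n) stands for the edge e_{j+1} (j = 0 : e_1 on H_1,
-- i.e. ab; j = n : e_{n+1} = e_1 on H_n, i.e. dc).  e_{j+1} = p j q j,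
-- where H_{j+1} traversed clockwise runs p j → q j.  Hexagon H_{i+1}
-- (i : Fin n) has the two further vertices w i 0, w i 1; traversed
-- clockwise it is
--   p i → q i → X → q (i+1) → p (i+1) → Y → p i
-- with X = the first k_{i+1} - 1 of [w i 0, w i 1] and Y the rest.

data HV (n : ℕ) : Set where
  p q : Fin (suc n) → HV n
  w   : Fin n → Fin 2 → HV n

_≟HV_ : {n : ℕ} → DecidableEquality (HV n)
p i ≟HV p j with i FinP.≟ j
... | yes refl = yes refl
... | no ne = no λ { refl → ne refl }
p i ≟HV q j = no λ ()
p i ≟HV w j l = no λ ()
q i ≟HV p j = no λ ()
q i ≟HV q j with i FinP.≟ j
... | yes refl = yes refl
... | no ne = no λ { refl → ne refl }
q i ≟HV w j l = no λ ()
w i l ≟HV p j = no λ ()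
w i l ≟HV q j = no λ ()
w i l ≟HV w j l' with i FinP.≟ j | l FinP.≟ l'
... | yes refl | yes refl = yes refl
... | no ne | _ = no λ { refl → ne refl }
... | yes _ | no ne = no λ { refl → ne refl }

module _ {n : ℕ} (k : Fin n → ℕ) where

  inner : Fin n → List (HV n)
  inner i = w i zero ∷ w i (suc zero) ∷ []

  Xs Ys : Fin n → List (HV n)
  Xs i = take (k i ∸ 1) (inner i)
  Ys i = drop (k i ∸ 1) (inner i)

  qPath pPath : Fin n → List (HV n)
  qPath i = q (inject₁ i) ∷ Xs i ++ q (suc i) ∷ []
  pPath i = p (suc i) ∷ Ys i ++ p (inject₁ i) ∷ []

pathEdges : {A : Set} → List A → List (Edge A)
pathEdges [] = []
pathEdges (x ∷ []) = []
pathEdges (x ∷ y ∷ xs) = (x , y) ∷ pathEdges (y ∷ xs)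

chainEdges : (n : ℕ) → (Fin n → ℕ) → List (Edge (HV n))
chainEdges n k = map (λ j → (p j , q j)) (allFin (suc n))
              ++ concatMap (λ i → pathEdges (qPath k i) ++ pathEdges (pPath k i)) (allFin n)

vA vB vC vD : (n : ℕ) → HV n
vA n = q zero
vB n = p zero
vD n = q (fromℕ n)
vC n = p (fromℕ n)

lastOf : {A : Set} → A → List A → A
lastOf x [] = x
lastOf x (y ∷ ys) = lastOf y ys

headOr : {A : Set} → A → List A → A
headOr x [] = x
headOr x (y ∷ _) = y

-- e : neighbour of d on H_n other than c ; f : neighbour of c on H_n other than d
vE vF : (n : ℕ) → (Fin n → ℕ) → HV n
vE zero k = p zero
vE (suc m) k = lastOf (q (inject₁ (fromℕ m))) (Xs k (fromℕ m))
vF zero k = p zero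
vF (suc m) k = headOr (p (inject₁ (fromℕ m))) (Ys k (fromℕ m))

-- K : an arbitrary simple graph on Fin (2 + m); vertex 0 is d, vertex 1
-- is c, the other m vertices are new (disjoint from G).  F = G ∪ K lives
-- on HV n ⊎ Fin m.

FV : ℕ → ℕ → Set
FV n m = HV n ⊎ Fin m

_≟F_ : {n m : ℕ} → DecidableEquality (FV n m)
_≟F_ = SumP.≡-dec _≟HV_ FinP._≟_

embedK : (n : ℕ) {m : ℕ} → Fin (suc (suc m)) → FV n m
embedK n zero = inj₁ (vD n)
embedK n (suc zero) = inj₁ (vC n)
embedK n (suc (suc j)) = inj₂ j

FEdges : (n : ℕ) → (Fin n → ℕ) → (m : ℕ) → List (Edge (Fin (suc (suc m)))) → List (Edge (FV n m))
FEdges n k m KE = Matching.union _≟F_ (map (mapEdge inj₁) (chainEdges n k)) (map (mapEdge (embedK n)) KE)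

{-# OPTIONS --safe #-}
-- Cut F at the two vertices that the first hexagon shares with the rest of the graph.  A maximal
-- matching of F is a matching s of the hexagon together with a matching t of the rest, and whether
-- the pair is admissible depends on t only through a signature of seven bits: whether t is a
-- matching, whether it covers each cut vertex, and whether it dominates the rest once either cut
-- vertex is also counted as covered.  Grouping the matchings t by signature writes every component
-- of Ψ_ab(F) as a combination of the components of Ψ_xy of the rest, with coefficients counted
-- inside the hexagon alone; exhaustive evaluation shows that these coefficients are the entries of
-- L, S or R.  Peeling the hexagons off one by one produces the product M.  The last two hexagons,
-- which carry the constraints at e and f, are glued in the same way to K together with the edge dc;
-- there evaluation shows that only the component Ψ(K | d) survives, with coefficient M[i,8].
module Submission where

open import Defs
open import Data.Nat using (ℕ; zero; suc; _+_; _*_; _∸_; _≤_; s≤s; _≡ᵇ_)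
open import Data.Nat.Properties
  using (+-assoc; +-comm; +-identityʳ; *-zeroʳ; *-distribˡ-+; *-distribʳ-+; *-assoc; *-comm; ≡ᵇ⇒≡)
open import Data.Fin using (Fin; zero; suc; fromℕ; inject₁; toℕ; _≟_)
open import Data.Bool using (Bool; true; false; _∧_; _∨_; not; if_then_else_; T)
open import Data.Bool.Properties
  using (∧-assoc; ∨-assoc; ∧-identityʳ; ∨-identityʳ; ∨-comm; ∨-zeroʳ; ∧-zeroʳ; ∧-conicalˡ; ∧-conicalʳ;
         ∨-conicalˡ; ∨-conicalʳ; T-∧; T-≡)
  renaming (_≟_ to _≟ᵇ_)
open import Data.Vec using (Vec; []; _∷_; lookup)
open import Data.List.Base using (List; []; _∷_; _++_; map; allFin; concatMap; concat; filterᵇ)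
import Data.List.Properties as List
open import Data.List.Relation.Unary.All using (All; []; _∷_)
import Data.List.Relation.Unary.All as All
import Data.List.Relation.Unary.All.Properties as All
open import Data.List.Relation.Unary.AllPairs using (AllPairs; []; _∷_)
open import Data.List.Relation.Unary.Any using (Any; here; there)
open import Data.List.Membership.Propositional using (_∈_; find)
open import Data.List.Membership.Propositional.Properties using (∈-map⁺; ∈-++⁺ˡ; ∈-allFin; ∈-∃++)
open import Data.List.Relation.Binary.Permutation.Propositional as ↭ using (_↭_)
import Data.List.Relation.Binary.Permutation.Propositional.Properties as ↭
open import Data.Product using (_×_; _,_; proj₁; proj₂)
open import Data.Sum using (inj₁; inj₂)
open import Data.Sum.Properties using (inj₁-injective)
open import Data.Empty using (⊥-elim)
open import Function.Base using (_∘_)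
open import Function.Bundles using (Equivalence)
open import Relation.Nullary using (¬_; yes; no; does)
open import Relation.Nullary.Decidable using (isYes; toWitness; dec-true; dec-false)
open import Relation.Binary.Definitions using (DecidableEquality)
open import Relation.Binary.PropositionalEquality
  using (_≡_; _≢_; refl; sym; trans; cong; cong₂; subst₂; module ≡-Reasoning)

private
  variable
    A B : Set

BoolFun : ℕ → Set
BoolFun zero = Bool
BoolFun (suc n) = Bool → BoolFun n

_$ⁿ_ : ∀ {n} → BoolFun n → Vec Bool n → Bool
f $ⁿ [] = f
f $ⁿ (b ∷ ρ) = f b $ⁿ ρ

sameTruthTable : ∀ n → BoolFun n → BoolFun n → Bool
sameTruthTable zero f g = isYes (f ≟ᵇ g)
sameTruthTable (suc n) f g = sameTruthTable n (f true) (g true) ∧ sameTruthTable n (f false) (g false)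

tautology : ∀ n (f g : BoolFun n) {_ : T (sameTruthTable n f g)} ρ → f $ⁿ ρ ≡ g $ⁿ ρ
tautology zero f g {h} [] = toWitness h
tautology (suc n) f g {h} (true ∷ ρ) = tautology n (f true) (g true) {proj₁ (Equivalence.to T-∧ h)} ρ
tautology (suc n) f g {h} (false ∷ ρ) = tautology n (f false) (g false) {proj₂ (Equivalence.to T-∧ h)} ρ

∧-cong-if : ∀ {b b' c c'} → b ≡ b' → (b ≡ true → c ≡ c') → b ∧ c ≡ b' ∧ c'
∧-cong-if {true} refl h = cong (true ∧_) (h refl)
∧-cong-if {false} refl h = refl

not-∧-not : ∀ a b → not a ∧ not b ≡ true → a ≡ false × b ≡ false
not-∧-not false false _ = refl , refl
not-∧-not true b ()
not-∧-not false true ()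

allᵇ-++ : (P : A → Bool) (xs ys : List A) → allᵇ P (xs ++ ys) ≡ allᵇ P xs ∧ allᵇ P ys
allᵇ-++ P [] ys = refl
allᵇ-++ P (x ∷ xs) ys = trans (cong (P x ∧_) (allᵇ-++ P xs ys)) (sym (∧-assoc (P x) _ _))

anyᵇ-++ : (P : A → Bool) (xs ys : List A) → anyᵇ P (xs ++ ys) ≡ anyᵇ P xs ∨ anyᵇ P ys
anyᵇ-++ P [] ys = refl
anyᵇ-++ P (x ∷ xs) ys = trans (cong (P x ∨_) (anyᵇ-++ P xs ys)) (sym (∨-assoc (P x) _ _))

allᵇ-map : (P : B → Bool) (f : A → B) (xs : List A) → allᵇ P (map f xs) ≡ allᵇ (λ x → P (f x)) xs
allᵇ-map P f [] = refl
allᵇ-map P f (x ∷ xs) = cong (P (f x) ∧_) (allᵇ-map P f xs)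

anyᵇ-map : (P : B → Bool) (f : A → B) (xs : List A) → anyᵇ P (map f xs) ≡ anyᵇ (λ x → P (f x)) xs
anyᵇ-map P f [] = refl
anyᵇ-map P f (x ∷ xs) = cong (P (f x) ∨_) (anyᵇ-map P f xs)

allᵇ-cong : {P Q : A → Bool} (xs : List A) → (∀ x → P x ≡ Q x) → allᵇ P xs ≡ allᵇ Q xs
allᵇ-cong [] e = refl
allᵇ-cong (x ∷ xs) e = cong₂ _∧_ (e x) (allᵇ-cong xs e)

allᵇ-cong-local : {P Q : A → Bool} {xs : List A} → All (λ x → P x ≡ Q x) xs → allᵇ P xs ≡ allᵇ Q xs
allᵇ-cong-local [] = refl
allᵇ-cong-local (e ∷ es) = cong₂ _∧_ e (allᵇ-cong-local es)

anyᵇ-cong : {P Q : A → Bool} (xs : List A) → (∀ x → P x ≡ Q x) → anyᵇ P xs ≡ anyᵇ Q xs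
anyᵇ-cong [] e = refl
anyᵇ-cong (x ∷ xs) e = cong₂ _∨_ (e x) (anyᵇ-cong xs e)

anyᵇ-∨ : (P Q : A → Bool) (xs : List A) → anyᵇ (λ x → P x ∨ Q x) xs ≡ anyᵇ P xs ∨ anyᵇ Q xs
anyᵇ-∨ P Q [] = refl
anyᵇ-∨ P Q (x ∷ xs) = trans (cong ((P x ∨ Q x) ∨_) (anyᵇ-∨ P Q xs))
  (tautology 4 (λ a b c d → (a ∨ b) ∨ (c ∨ d)) (λ a b c d → (a ∨ c) ∨ (b ∨ d))
     (P x ∷ Q x ∷ anyᵇ P xs ∷ anyᵇ Q xs ∷ []))

anyᵇ-∧ˡ : (b : Bool) (P : A → Bool) (xs : List A) → anyᵇ (λ x → b ∧ P x) xs ≡ b ∧ anyᵇ P xs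
anyᵇ-∧ˡ true P xs = refl
anyᵇ-∧ˡ false P [] = refl
anyᵇ-∧ˡ false P (x ∷ xs) = anyᵇ-∧ˡ false P xs

anyᵇ-false : (P : A → Bool) (xs : List A) → (∀ x → P x ≡ false) → anyᵇ P xs ≡ false
anyᵇ-false P [] h = refl
anyᵇ-false P (x ∷ xs) h = trans (cong (_∨ anyᵇ P xs) (h x)) (anyᵇ-false P xs h)

anyᵇ-false-local : {P : A → Bool} {xs : List A} → All (λ x → P x ≡ false) xs → anyᵇ P xs ≡ false
anyᵇ-false-local [] = refl
anyᵇ-false-local {P = P} {x ∷ xs} (h ∷ hs) = trans (cong (_∨ anyᵇ P xs) h) (anyᵇ-false-local hs)

anyᵇ-∈ : (P : A → Bool) {x : A} {xs : List A} → x ∈ xs → P x ≡ true → anyᵇ P xs ≡ true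
anyᵇ-∈ P (here refl) Px rewrite Px = refl
anyᵇ-∈ P {xs = y ∷ ys} (there x∈ys) Px rewrite anyᵇ-∈ P x∈ys Px = ∨-zeroʳ (P y)

count-++ : (P : A → Bool) (xs ys : List A) → count P (xs ++ ys) ≡ count P xs + count P ys
count-++ P [] ys = refl
count-++ P (x ∷ xs) ys with P x
... | true = cong suc (count-++ P xs ys)
... | false = count-++ P xs ys

count-map : (P : B → Bool) (f : A → B) (xs : List A) → count P (map f xs) ≡ count (λ x → P (f x)) xs
count-map P f [] = refl
count-map P f (x ∷ xs) with P (f x)
... | true = cong suc (count-map P f xs)
... | false = count-map P f xs

count-cong : {P Q : A → Bool} (xs : List A) → (∀ x → P x ≡ Q x) → count P xs ≡ count Q xs
count-cong [] e = refl
count-cong {Q = Q} (x ∷ xs) e with e x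
... | eq rewrite eq with Q x
...   | true = cong suc (count-cong xs e)
...   | false = count-cong xs e

count-cong-local : {P Q : A → Bool} {xs : List A} → All (λ x → P x ≡ Q x) xs → count P xs ≡ count Q xs
count-cong-local [] = refl
count-cong-local {Q = Q} {x ∷ xs} (e ∷ es) rewrite e with Q x
... | true = cong suc (count-cong-local es)
... | false = count-cong-local es

count-false : (xs : List A) → count (λ _ → false) xs ≡ 0
count-false [] = refl
count-false (x ∷ xs) = count-false xs

indicator : Bool → ℕ
indicator true = 1
indicator false = 0

indicator-∧ : ∀ a b → indicator (a ∧ b) ≡ indicator b * indicator a
indicator-∧ true true = refl
indicator-∧ true false = refl
indicator-∧ false true = refl
indicator-∧ false false = refl

sumOver : (A → ℕ) → List A → ℕ
sumOver f [] = 0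
sumOver f (x ∷ xs) = f x + sumOver f xs

count≡sumOver : (P : A → Bool) (xs : List A) → count P xs ≡ sumOver (λ x → indicator (P x)) xs
count≡sumOver P [] = refl
count≡sumOver P (x ∷ xs) with P x
... | true = cong suc (count≡sumOver P xs)
... | false = count≡sumOver P xs

sumOver-++ : (f : A → ℕ) (xs ys : List A) → sumOver f (xs ++ ys) ≡ sumOver f xs + sumOver f ys
sumOver-++ f [] ys = refl
sumOver-++ f (x ∷ xs) ys = trans (cong (f x +_) (sumOver-++ f xs ys)) (sym (+-assoc (f x) _ _))

sumOver-map : (f : B → ℕ) (g : A → B) (xs : List A) → sumOver f (map g xs) ≡ sumOver (λ x → f (g x)) xs
sumOver-map f g [] = refl
sumOver-map f g (x ∷ xs) = cong (f (g x) +_) (sumOver-map f g xs)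

sumOver-cong : {f g : A → ℕ} (xs : List A) → (∀ x → f x ≡ g x) → sumOver f xs ≡ sumOver g xs
sumOver-cong [] e = refl
sumOver-cong (x ∷ xs) e = cong₂ _+_ (e x) (sumOver-cong xs e)

+-interchange : ∀ a b c d → (a + b) + (c + d) ≡ (a + c) + (b + d)
+-interchange a b c d = begin
  (a + b) + (c + d) ≡⟨ +-assoc a b (c + d) ⟩
  a + (b + (c + d)) ≡⟨ cong (a +_) (sym (+-assoc b c d)) ⟩
  a + ((b + c) + d) ≡⟨ cong (λ z → a + (z + d)) (+-comm b c) ⟩
  a + ((c + b) + d) ≡⟨ cong (a +_) (+-assoc c b d) ⟩
  a + (c + (b + d)) ≡⟨ sym (+-assoc a c (b + d)) ⟩
  (a + c) + (b + d) ∎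
  where open ≡-Reasoning

sumOver-+ : (f g : A → ℕ) (xs : List A) → sumOver (λ x → f x + g x) xs ≡ sumOver f xs + sumOver g xs
sumOver-+ f g [] = refl
sumOver-+ f g (x ∷ xs) = trans (cong ((f x + g x) +_) (sumOver-+ f g xs)) (+-interchange (f x) (g x) _ _)

sumOver-zero : (xs : List A) → sumOver (λ _ → 0) xs ≡ 0
sumOver-zero [] = refl
sumOver-zero (x ∷ xs) = sumOver-zero xs

sumOver-swap : (f : A → B → ℕ) (xs : List A) (ys : List B) →
  sumOver (λ x → sumOver (f x) ys) xs ≡ sumOver (λ y → sumOver (λ x → f x y) xs) ys
sumOver-swap f [] ys = sym (sumOver-zero ys)
sumOver-swap f (x ∷ xs) ys =
  trans (cong (sumOver (f x) ys +_) (sumOver-swap f xs ys)) (sym (sumOver-+ (f x) _ ys))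

sumOver-*ˡ : (c : ℕ) (f : A → ℕ) (xs : List A) → sumOver (λ x → c * f x) xs ≡ c * sumOver f xs
sumOver-*ˡ c f [] = sym (*-zeroʳ c)
sumOver-*ˡ c f (x ∷ xs) = trans (cong (c * f x +_) (sumOver-*ˡ c f xs)) (sym (*-distribˡ-+ c (f x) _))

sublists-map : (f : A → B) (xs : List A) → sublists (map f xs) ≡ map (map f) (sublists xs)
sublists-map f [] = refl
sublists-map f (x ∷ xs) rewrite sublists-map f xs =
  sym (trans (List.map-++ (map f) (sublists xs) (map (x ∷_) (sublists xs)))
         (cong (map (map f) (sublists xs) ++_) (trans (sym (List.map-∘ (sublists xs))) (List.map-∘ (sublists xs)))))

count-sublists-∷ : (P : List A → Bool) (x : A) (xs : List A) →
  count P (sublists (x ∷ xs)) ≡ count P (sublists xs) + count (λ s → P (x ∷ s)) (sublists xs)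
count-sublists-∷ P x xs =
  trans (count-++ P (sublists xs) (map (x ∷_) (sublists xs)))
        (cong (count P (sublists xs) +_) (count-map P (x ∷_) (sublists xs)))

count-sublists-++ : (P : List A → Bool) (xs ys : List A) →
  count P (sublists (xs ++ ys)) ≡ sumOver (λ s → count (λ t → P (s ++ t)) (sublists ys)) (sublists xs)
count-sublists-++ P [] ys = sym (+-identityʳ _)
count-sublists-++ P (x ∷ xs) ys = begin
  count P (sublists (x ∷ xs ++ ys))
    ≡⟨ count-sublists-∷ P x (xs ++ ys) ⟩
  count P (sublists (xs ++ ys)) + count (λ s → P (x ∷ s)) (sublists (xs ++ ys))
    ≡⟨ cong₂ _+_ (count-sublists-++ P xs ys) (count-sublists-++ (λ s → P (x ∷ s)) xs ys) ⟩
  sumOver g (sublists xs) + sumOver (λ s → g (x ∷ s)) (sublists xs)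
    ≡⟨ cong (sumOver g (sublists xs) +_) (sym (sumOver-map g (x ∷_) (sublists xs))) ⟩
  sumOver g (sublists xs) + sumOver g (map (x ∷_) (sublists xs))
    ≡⟨ sym (sumOver-++ g (sublists xs) _) ⟩
  sumOver g (sublists (x ∷ xs)) ∎
  where
  open ≡-Reasoning
  g : List _ → ℕ
  g s = count (λ t → P (s ++ t)) (sublists ys)

All-sublists : {P : A → Set} {xs : List A} → All P xs → All (All P) (sublists xs)
All-sublists [] = [] ∷ []
All-sublists (px ∷ ps) = All.++⁺ (All-sublists ps) (All.map⁺ (All.map (px ∷_) (All-sublists ps)))

sumFin-cong : ∀ n {f g : Fin n → ℕ} → (∀ i → f i ≡ g i) → sumFin n f ≡ sumFin n g
sumFin-cong zero h = refl
sumFin-cong (suc n) h = cong₂ _+_ (h zero) (sumFin-cong n (λ i → h (suc i)))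

*-sumFin : ∀ c n (f : Fin n → ℕ) → c * sumFin n f ≡ sumFin n (λ l → c * f l)
*-sumFin c zero f = *-zeroʳ c
*-sumFin c (suc n) f = trans (*-distribˡ-+ c (f zero) _) (cong (c * f zero +_) (*-sumFin c n (λ l → f (suc l))))

sumFin-*-assoc : ∀ n (f g : Fin n → ℕ) c → sumFin n (λ l → f l * (g l * c)) ≡ sumFin n (λ l → f l * g l) * c
sumFin-*-assoc zero f g c = refl
sumFin-*-assoc (suc n) f g c =
  trans (cong₂ _+_ (sym (*-assoc (f zero) (g zero) c)) (sumFin-*-assoc n (λ l → f (suc l)) (λ l → g (suc l)) c))
        (sym (*-distribʳ-+ c (f zero * g zero) _))

sumOver-sumFin : ∀ n (g : Fin n → A → ℕ) (xs : List A) →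
  sumOver (λ t → sumFin n (λ l → g l t)) xs ≡ sumFin n (λ l → sumOver (g l) xs)
sumOver-sumFin zero g xs = sumOver-zero xs
sumOver-sumFin (suc n) g xs =
  trans (sumOver-+ (g zero) (λ t → sumFin n (λ l → g (suc l) t)) xs)
        (cong (sumOver (g zero) xs +_) (sumOver-sumFin n (λ l → g (suc l)) xs))

sumOver-*-sumFin : ∀ n (c : A → ℕ) (a : Fin n → ℕ) (f : Fin n → A → ℕ) (xs : List A) →
  sumOver (λ t → c t * sumFin n (λ l → a l * f l t)) xs ≡ sumFin n (λ l → a l * sumOver (λ t → c t * f l t) xs)
sumOver-*-sumFin n c a f xs = begin
  sumOver (λ t → c t * sumFin n (λ l → a l * f l t)) xs
    ≡⟨ sumOver-cong xs (λ t → trans (*-sumFin (c t) n _) (sumFin-cong n (λ l → *-comm-middle (c t) (a l) (f l t)))) ⟩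
  sumOver (λ t → sumFin n (λ l → a l * (c t * f l t))) xs
    ≡⟨ sumOver-sumFin n (λ l t → a l * (c t * f l t)) xs ⟩
  sumFin n (λ l → sumOver (λ t → a l * (c t * f l t)) xs)
    ≡⟨ sumFin-cong n (λ l → sumOver-*ˡ (a l) (λ t → c t * f l t) xs) ⟩
  sumFin n (λ l → a l * sumOver (λ t → c t * f l t) xs) ∎
  where
  open ≡-Reasoning
  *-comm-middle : ∀ u v r → u * (v * r) ≡ v * (u * r)
  *-comm-middle u v r = trans (sym (*-assoc u v r)) (trans (cong (_* r) (*-comm u v)) (*-assoc v u r))

mapEdges : (A → B) → List (Edge A) → List (Edge B)
mapEdges f = map (mapEdge f)

mapConstraints : (A → B) → Constraints A → Constraints B
mapConstraints f (cons a b c d) = cons (map f a) (mapEdges f b) (map f c) (mapEdges f d)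

_⊕_ : Constraints A → Constraints A → Constraints A
cons a b c d ⊕ cons a' b' c' d' = cons (a ++ a') (b ++ b') (c ++ c') (d ++ d')

module MatchingFacts {V : Set} (_≟_ : DecidableEquality V) where
  open Matching _≟_

  ==-refl : ∀ x → (x == x) ≡ true
  ==-refl x = dec-true (x ≟ x) refl

  ==-≢ : ∀ {x y} → x ≢ y → (x == y) ≡ false
  ==-≢ {x} {y} = dec-false (x ≟ y)

  ==⇒≡ : ∀ {x y} → (x == y) ≡ true → x ≡ y
  ==⇒≡ {x} {y} h with x ≟ y
  ... | yes x≡y = x≡y

  ==-sym : ∀ x y → (x == y) ≡ (y == x)
  ==-sym x y with x ≟ y | y ≟ x
  ... | yes _ | yes _ = refl
  ... | no _ | no _ = refl
  ... | yes x≡y | no y≢x = ⊥-elim (y≢x (sym x≡y))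
  ... | no x≢y | yes y≡x = ⊥-elim (x≢y (sym y≡x))

  dominates : List (Edge V) → Edge V → Bool
  dominates S e = covers S (proj₁ e) ∨ covers S (proj₂ e)

  covers-++ : ∀ S S' z → covers (S ++ S') z ≡ covers S z ∨ covers S' z
  covers-++ S S' z = anyᵇ-++ (incident z) S S'

  memE-++ : ∀ e S S' → memE e (S ++ S') ≡ memE e S ∨ memE e S'
  memE-++ e S S' = anyᵇ-++ (sameEdge e) S S'

  shares≡dominates : ∀ e S → anyᵇ (shareVertex e) S ≡ dominates S e
  shares≡dominates (u , v) S = anyᵇ-∨ (incident u) (incident v) S

  isMatching-++ : ∀ S S' → isMatching (S ++ S')
    ≡ isMatching S ∧ (isMatching S' ∧ allᵇ (λ e → not (anyᵇ (shareVertex e) S')) S)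
  isMatching-++ [] S' = sym (∧-identityʳ (isMatching S'))
  isMatching-++ (e ∷ S) S' rewrite anyᵇ-++ (shareVertex e) S S' | isMatching-++ S S' =
    tautology 5 (λ a b c d f → not (a ∨ b) ∧ (c ∧ (d ∧ f))) (λ a b c d f → (not a ∧ c) ∧ (d ∧ (not b ∧ f)))
      (anyᵇ (shareVertex e) S ∷ anyᵇ (shareVertex e) S' ∷ isMatching S ∷ isMatching S'
        ∷ allᵇ (λ e → not (anyᵇ (shareVertex e) S')) S ∷ [])

  memE⇒covers : ∀ u v S → memE (u , v) S ≡ true → covers S u ≡ true
  memE⇒covers u v ((c , d) ∷ S) h with c == u in c≡u | d == u in d≡u
  ... | true | _ = refl
  ... | false | true = refl
  ... | false | false with u == c in u≡c | u == d in u≡d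
  ...   | true | _ with () ← trans (sym c≡u) (trans (==-sym c u) u≡c)
  ...   | false | true with () ← trans (sym d≡u) (trans (==-sym d u) u≡d)
  ...   | false | false = memE⇒covers u v S h

  isMaximal≡dominates : ∀ E S → isMatching S ≡ true → isMaximal E S ≡ allᵇ (dominates S) E
  isMaximal≡dominates E S matching = allᵇ-cong E extendable
    where
    extendable : ∀ e → (memE e S ∨ not (isMatching (e ∷ S))) ≡ dominates S e
    extendable (u , v) rewrite matching | shares≡dominates (u , v) S with memE (u , v) S in uv∈S
    ... | false = tautology 1 (λ a → not (not a ∧ true)) (λ a → a) (dominates S (u , v) ∷ [])
    ... | true rewrite memE⇒covers u v S uv∈S = refl

  satisfies : Constraints V → List (Edge V) → Bool
  satisfies C t = allᵇ (λ z → not (covers t z)) (avoidV C) ∧ (allᵇ (λ e → not (memE e t)) (avoidE C)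
    ∧ (allᵇ (covers t) (coverV C) ∧ allᵇ (λ e → memE e t) (containE C)))

  ok≡dominates : ∀ C E t → ok C E t ≡ isMatching t ∧ (allᵇ (dominates t) E ∧ satisfies C t)
  ok≡dominates C E t = ∧-cong-if refl (λ m → cong (_∧ satisfies C t) (isMaximal≡dominates E t m))

  delV-++ : ∀ z E E' → delV z (E ++ E') ≡ delV z E ++ delV z E'
  delV-++ z [] E' = refl
  delV-++ z (e ∷ E) E' with incident z e
  ... | true = delV-++ z E E'
  ... | false = cong (e ∷_) (delV-++ z E E')

  delV-fresh : ∀ z {E} → All (λ e → incident z e ≡ false) E → delV z E ≡ E
  delV-fresh z [] = refl
  delV-fresh z {e ∷ E} (z∉e ∷ z∉E) rewrite z∉e = cong (e ∷_) (delV-fresh z z∉E)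

module Renaming {V W : Set} (_≟V_ : DecidableEquality V) (_≟W_ : DecidableEquality W)
                (φ : V → W) (φ-injective : ∀ {u v} → φ u ≡ φ v → u ≡ v) where
  private
    module M = Matching _≟V_
    module N = Matching _≟W_
    module NF = MatchingFacts _≟W_

  ==-rename : ∀ u v → (φ u N.== φ v) ≡ (u M.== v)
  ==-rename u v with u ≟V v
  ... | yes refl = NF.==-refl (φ u)
  ... | no u≢v = NF.==-≢ (λ e → u≢v (φ-injective e))

  incident-rename : ∀ z e → N.incident (φ z) (mapEdge φ e) ≡ M.incident z e
  incident-rename z (u , v) = cong₂ _∨_ (==-rename u z) (==-rename v z)

  covers-rename : ∀ S z → N.covers (mapEdges φ S) (φ z) ≡ M.covers S z
  covers-rename S z = trans (anyᵇ-map (N.incident (φ z)) (mapEdge φ) S) (anyᵇ-cong S (incident-rename z))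

  sameEdge-rename : ∀ e e' → N.sameEdge (mapEdge φ e) (mapEdge φ e') ≡ M.sameEdge e e'
  sameEdge-rename (u , v) (u' , v') rewrite ==-rename u u' | ==-rename v v' | ==-rename u v' | ==-rename v u' = refl

  memE-rename : ∀ e S → N.memE (mapEdge φ e) (mapEdges φ S) ≡ M.memE e S
  memE-rename e S = trans (anyᵇ-map (N.sameEdge (mapEdge φ e)) (mapEdge φ) S) (anyᵇ-cong S (sameEdge-rename e))

  shares-rename : ∀ e S → anyᵇ (N.shareVertex (mapEdge φ e)) (mapEdges φ S) ≡ anyᵇ (M.shareVertex e) S
  shares-rename (u , v) S = trans (anyᵇ-map _ (mapEdge φ) S)
    (anyᵇ-cong S (λ e → cong₂ _∨_ (incident-rename u e) (incident-rename v e)))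

  isMatching-rename : ∀ S → N.isMatching (mapEdges φ S) ≡ M.isMatching S
  isMatching-rename [] = refl
  isMatching-rename (e ∷ S) = cong₂ (λ a b → not a ∧ b) (shares-rename e S) (isMatching-rename S)

  isMaximal-rename : ∀ E S → N.isMaximal (mapEdges φ E) (mapEdges φ S) ≡ M.isMaximal E S
  isMaximal-rename E S = trans (allᵇ-map _ (mapEdge φ) E) (allᵇ-cong E (λ e →
    cong₂ (λ a b → a ∨ not b) (memE-rename e S) (cong₂ (λ a b → not a ∧ b) (shares-rename e S) (isMatching-rename S))))

  ok-rename : ∀ C E S → N.ok (mapConstraints φ C) (mapEdges φ E) (mapEdges φ S) ≡ M.ok C E S
  ok-rename (cons a b c d) E S =
    cong₂ _∧_ (isMatching-rename S) (cong₂ _∧_ (isMaximal-rename E S)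
      (cong₂ _∧_ (trans (allᵇ-map _ φ a) (allᵇ-cong a (λ z → cong not (covers-rename S z))))
      (cong₂ _∧_ (trans (allᵇ-map _ (mapEdge φ) b) (allᵇ-cong b (λ e → cong not (memE-rename e S))))
      (cong₂ _∧_ (trans (allᵇ-map _ φ c) (allᵇ-cong c (covers-rename S)))
                 (trans (allᵇ-map _ (mapEdge φ) d) (allᵇ-cong d (λ e → memE-rename e S)))))))

  Ψ-rename : ∀ C E → N.Ψ (mapConstraints φ C) (mapEdges φ E) ≡ M.Ψ C E
  Ψ-rename C E rewrite sublists-map (mapEdge φ) E =
    trans (count-map (N.ok (mapConstraints φ C) (mapEdges φ E)) (mapEdges φ) (sublists E))
          (count-cong (sublists E) (ok-rename C E))

  delV-rename : ∀ z E → N.delV (φ z) (mapEdges φ E) ≡ mapEdges φ (M.delV z E)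
  delV-rename z [] = refl
  delV-rename z (e ∷ E) rewrite incident-rename z e with M.incident z e
  ... | true = delV-rename z E
  ... | false = cong (mapEdge φ e ∷_) (delV-rename z E)

allᵇ-↭ : (P : A → Bool) {xs ys : List A} → xs ↭ ys → allᵇ P xs ≡ allᵇ P ys
allᵇ-↭ P ↭.refl = refl
allᵇ-↭ P (↭.prep x xs↭ys) = cong (P x ∧_) (allᵇ-↭ P xs↭ys)
allᵇ-↭ P (↭.swap x y xs↭ys) rewrite allᵇ-↭ P xs↭ys =
  tautology 3 (λ a b c → a ∧ (b ∧ c)) (λ a b c → b ∧ (a ∧ c)) (P x ∷ P y ∷ _ ∷ [])
allᵇ-↭ P (↭.trans xs↭ys ys↭zs) = trans (allᵇ-↭ P xs↭ys) (allᵇ-↭ P ys↭zs)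

anyᵇ-↭ : (P : A → Bool) {xs ys : List A} → xs ↭ ys → anyᵇ P xs ≡ anyᵇ P ys
anyᵇ-↭ P ↭.refl = refl
anyᵇ-↭ P (↭.prep x xs↭ys) = cong (P x ∨_) (anyᵇ-↭ P xs↭ys)
anyᵇ-↭ P (↭.swap x y xs↭ys) rewrite anyᵇ-↭ P xs↭ys =
  tautology 3 (λ a b c → a ∨ (b ∨ c)) (λ a b c → b ∨ (a ∨ c)) (P x ∷ P y ∷ _ ∷ [])
anyᵇ-↭ P (↭.trans xs↭ys ys↭zs) = trans (anyᵇ-↭ P xs↭ys) (anyᵇ-↭ P ys↭zs)

count-sublists-↭ : (P : List A → Bool) → (∀ {S S'} → S ↭ S' → P S ≡ P S') →
  {xs ys : List A} → xs ↭ ys → count P (sublists xs) ≡ count P (sublists ys)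
count-sublists-↭ P P-resp ↭.refl = refl
count-sublists-↭ P P-resp (↭.prep {xs} {ys} x xs↭ys) =
  trans (count-sublists-∷ P x xs) (trans (cong₂ _+_
    (count-sublists-↭ P P-resp xs↭ys)
    (count-sublists-↭ (λ S → P (x ∷ S)) (λ r → P-resp (↭.prep x r)) xs↭ys))
  (sym (count-sublists-∷ P x ys)))
count-sublists-↭ P P-resp (↭.swap {xs} {ys} x y xs↭ys) = begin
  count P (sublists (x ∷ y ∷ xs))
    ≡⟨ split P x y xs ⟩
  (c P xs + c (λ S → P (y ∷ S)) xs) + (c (λ S → P (x ∷ S)) xs + c (λ S → P (x ∷ y ∷ S)) xs)
    ≡⟨ cong₂ _+_ (cong₂ _+_ (IH P P-resp) (IH (λ S → P (y ∷ S)) (λ r → P-resp (↭.prep y r))))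
                 (cong₂ _+_ (IH (λ S → P (x ∷ S)) (λ r → P-resp (↭.prep x r)))
                            (trans (count-cong (sublists xs) (λ S → P-resp (↭.swap x y ↭.refl)))
                                   (IH (λ S → P (y ∷ x ∷ S)) (λ r → P-resp (↭.prep y (↭.prep x r)))))) ⟩
  (c P ys + c (λ S → P (y ∷ S)) ys) + (c (λ S → P (x ∷ S)) ys + c (λ S → P (y ∷ x ∷ S)) ys)
    ≡⟨ +-interchange (c P ys) (c (λ S → P (y ∷ S)) ys) (c (λ S → P (x ∷ S)) ys) _ ⟩
  (c P ys + c (λ S → P (x ∷ S)) ys) + (c (λ S → P (y ∷ S)) ys + c (λ S → P (y ∷ x ∷ S)) ys)
    ≡⟨ sym (split P y x ys) ⟩
  count P (sublists (y ∷ x ∷ ys)) ∎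
  where
  open ≡-Reasoning
  c : (List _ → Bool) → List _ → ℕ
  c Q zs = count Q (sublists zs)
  IH : (Q : List _ → Bool) → (∀ {S S'} → S ↭ S' → Q S ≡ Q S') → c Q xs ≡ c Q ys
  IH Q Q-resp = count-sublists-↭ Q Q-resp xs↭ys
  split : (Q : List _ → Bool) (a b : _) (zs : List _) →
    c Q (a ∷ b ∷ zs) ≡ (c Q zs + c (λ S → Q (b ∷ S)) zs) + (c (λ S → Q (a ∷ S)) zs + c (λ S → Q (a ∷ b ∷ S)) zs)
  split Q a b zs = trans (count-sublists-∷ Q a (b ∷ zs))
    (cong₂ _+_ (count-sublists-∷ Q b zs) (count-sublists-∷ (λ S → Q (a ∷ S)) b zs))
count-sublists-↭ P P-resp (↭.trans xs↭ys ys↭zs) =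
  trans (count-sublists-↭ P P-resp xs↭ys) (count-sublists-↭ P P-resp ys↭zs)

dropsX dropsY needsX needsY : Fin 9 → Bool
dropsX i = lookup (false ∷ true ∷ false ∷ true ∷ false ∷ true ∷ false ∷ false ∷ false ∷ []) i
dropsY i = lookup (false ∷ false ∷ true ∷ true ∷ false ∷ false ∷ true ∷ false ∷ false ∷ []) i
needsX i = lookup (false ∷ false ∷ false ∷ false ∷ true ∷ false ∷ true ∷ true ∷ false ∷ []) i
needsY i = lookup (false ∷ false ∷ false ∷ false ∷ true ∷ true ∷ false ∷ false ∷ true ∷ []) i

optional : Bool → A → List A
optional b z = if b then z ∷ [] else []

allᵇ-optional : ∀ (P : A → Bool) b z → allᵇ P (optional b z) ≡ not b ∨ P z
allᵇ-optional P true z = ∧-identityʳ (P z)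
allᵇ-optional P false z = refl

required : Fin 9 → A → A → List A
required i x y = optional (needsX i) x ++ optional (needsY i) y

map-required : (f : A → B) (i : Fin 9) (x y : A) → map f (required i x y) ≡ required i (f x) (f y)
map-required f i x y = trans (List.map-++ f (optional (needsX i) x) _)
  (cong₂ _++_ (map-optional (needsX i) x) (map-optional (needsY i) y))
  where
  map-optional : ∀ b z → map f (optional b z) ≡ optional b (f z)
  map-optional true z = refl
  map-optional false z = refl

module IndexShape {V : Set} (_≟_ : DecidableEquality V) where
  open Matching _≟_

  delIf : Bool → V → List (Edge V) → List (Edge V)
  delIf b z E = if b then delV z E else E

  deleted : Fin 9 → V → V → List (Edge V) → List (Edge V)
  deleted i x y E = delIf (dropsY i) y (delIf (dropsX i) x E)

  Ψvec-uniform : ∀ C E x y i → Ψvec C E x y i ≡ Ψ (addCover (required i x y) C) (deleted i x y E)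
  Ψvec-uniform (cons _ _ _ _) E x y zero = refl
  Ψvec-uniform (cons _ _ _ _) E x y (suc zero) = refl
  Ψvec-uniform (cons _ _ _ _) E x y (suc (suc zero)) = refl
  Ψvec-uniform (cons _ _ _ _) E x y (suc (suc (suc zero))) = refl
  Ψvec-uniform (cons _ _ _ _) E x y (suc (suc (suc (suc zero)))) = refl
  Ψvec-uniform (cons _ _ _ _) E x y (suc (suc (suc (suc (suc zero))))) = refl
  Ψvec-uniform (cons _ _ _ _) E x y (suc (suc (suc (suc (suc (suc zero)))))) = refl
  Ψvec-uniform (cons _ _ _ _) E x y (suc (suc (suc (suc (suc (suc (suc zero))))))) = refl
  Ψvec-uniform (cons _ _ _ _) E x y (suc (suc (suc (suc (suc (suc (suc (suc zero)))))))) = refl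

  not-covers-∷ : ∀ {z e b} → incident z e ≡ b → (P : List (Edge V) → Bool) → ∀ t
    → not (b ∨ covers t z) ∧ P (e ∷ t) ≡ not (covers (e ∷ t) z) ∧ P (e ∷ t)
  not-covers-∷ {z} {e} z∈e P t = cong (λ b → not (b ∨ covers t z) ∧ P (e ∷ t)) (sym z∈e)

  count-sublists-delV : ∀ z (P : List (Edge V) → Bool) E →
    count P (sublists (delV z E)) ≡ count (λ t → not (covers t z) ∧ P t) (sublists E)
  count-sublists-delV z P [] = refl
  count-sublists-delV z P (e ∷ E) with incident z e in z∈e
  ... | true = begin
    count P (sublists (delV z E))                     ≡⟨ count-sublists-delV z P E ⟩
    count Q (sublists E)                              ≡⟨ sym (+-identityʳ _) ⟩
    count Q (sublists E) + 0                          ≡⟨ cong (count Q (sublists E) +_) (sym (count-false (sublists E))) ⟩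
    count Q (sublists E) + count (λ _ → false) (sublists E)
      ≡⟨ cong (count Q (sublists E) +_) (count-cong (sublists E) (not-covers-∷ z∈e P)) ⟩
    count Q (sublists E) + count (λ t → Q (e ∷ t)) (sublists E) ≡⟨ sym (count-sublists-∷ Q e E) ⟩
    count Q (sublists (e ∷ E))                        ∎
    where
    open ≡-Reasoning
    Q : List (Edge V) → Bool
    Q t = not (covers t z) ∧ P t
  ... | false = begin
    count P (sublists (e ∷ delV z E))
      ≡⟨ count-sublists-∷ P e (delV z E) ⟩
    count P (sublists (delV z E)) + count (λ t → P (e ∷ t)) (sublists (delV z E))
      ≡⟨ cong₂ _+_ (count-sublists-delV z P E) (count-sublists-delV z (λ t → P (e ∷ t)) E) ⟩
    count Q (sublists E) + count (λ t → not (covers t z) ∧ P (e ∷ t)) (sublists E)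
      ≡⟨ cong (count Q (sublists E) +_) (count-cong (sublists E) (not-covers-∷ z∈e P)) ⟩
    count Q (sublists E) + count (λ t → Q (e ∷ t)) (sublists E)
      ≡⟨ sym (count-sublists-∷ Q e E) ⟩
    count Q (sublists (e ∷ E)) ∎
    where
    open ≡-Reasoning
    Q : List (Edge V) → Bool
    Q t = not (covers t z) ∧ P t

  count-sublists-delIf : ∀ b z (P : List (Edge V) → Bool) E →
    count P (sublists (delIf b z E)) ≡ count (λ t → not (b ∧ covers t z) ∧ P t) (sublists E)
  count-sublists-delIf true z P E = count-sublists-delV z P E
  count-sublists-delIf false z P E = refl

  allᵇ-delIf : ∀ b z (f : Edge V → Bool) E → allᵇ f (delIf b z E) ≡ allᵇ (λ e → (b ∧ incident z e) ∨ f e) E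
  allᵇ-delIf false z f E = refl
  allᵇ-delIf true z f [] = refl
  allᵇ-delIf true z f (e ∷ E) with incident z e
  ... | true = allᵇ-delIf true z f E
  ... | false = cong (f e ∧_) (allᵇ-delIf true z f E)

module Permutation {V : Set} (_≟_ : DecidableEquality V) where
  open Matching _≟_
  open MatchingFacts _≟_
  open IndexShape _≟_

  shareVertex-sym : ∀ e e' → shareVertex e e' ≡ shareVertex e' e
  shareVertex-sym (a , b) (c , d) rewrite ==-sym c a | ==-sym d a | ==-sym c b | ==-sym d b =
    tautology 4 (λ ac ad bc bd → (ac ∨ ad) ∨ (bc ∨ bd)) (λ ac ad bc bd → (ac ∨ bc) ∨ (ad ∨ bd))
      ((a == c) ∷ (a == d) ∷ (b == c) ∷ (b == d) ∷ [])

  isMatching-↭ : ∀ {S S'} → S ↭ S' → isMatching S ≡ isMatching S'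
  isMatching-↭ ↭.refl = refl
  isMatching-↭ (↭.prep e S↭S') = cong₂ (λ a b → not a ∧ b) (anyᵇ-↭ (shareVertex e) S↭S') (isMatching-↭ S↭S')
  isMatching-↭ (↭.swap {S} {S'} e e' S↭S')
    rewrite anyᵇ-↭ (shareVertex e) S↭S' | anyᵇ-↭ (shareVertex e') S↭S' | isMatching-↭ S↭S' | shareVertex-sym e e' =
    tautology 4 (λ a b c d → not (a ∨ b) ∧ (not c ∧ d)) (λ a b c d → not (a ∨ c) ∧ (not b ∧ d))
      (shareVertex e' e ∷ anyᵇ (shareVertex e) S' ∷ anyᵇ (shareVertex e') S' ∷ isMatching S' ∷ [])
  isMatching-↭ (↭.trans S↭S' S'↭S'') = trans (isMatching-↭ S↭S') (isMatching-↭ S'↭S'')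

  ok-↭-matching : ∀ C E {S S'} → S ↭ S' → ok C E S ≡ ok C E S'
  ok-↭-matching (cons a b c d) E {S} {S'} S↭S' =
    cong₂ _∧_ (isMatching-↭ S↭S') (cong₂ _∧_
      (allᵇ-cong E (λ e → cong₂ (λ u v → u ∨ not v) (memE-↭ e) (isMatching-↭ (↭.prep e S↭S'))))
      (cong₂ _∧_ (allᵇ-cong a (λ z → cong not (covers-↭ z)))
      (cong₂ _∧_ (allᵇ-cong b (λ e → cong not (memE-↭ e)))
      (cong₂ _∧_ (allᵇ-cong c covers-↭) (allᵇ-cong d memE-↭)))))
    where
    covers-↭ : ∀ z → covers S z ≡ covers S' z
    covers-↭ z = anyᵇ-↭ (incident z) S↭S'
    memE-↭ : ∀ e → memE e S ≡ memE e S'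
    memE-↭ e = anyᵇ-↭ (sameEdge e) S↭S'

  ok-↭-graph : ∀ C {E E'} S → E ↭ E' → ok C E S ≡ ok C E' S
  ok-↭-graph C S E↭E' = cong (λ m → isMatching S ∧ (m ∧ _)) (allᵇ-↭ _ E↭E')

  Ψ-↭ : ∀ C {E E'} → E ↭ E' → Ψ C E ≡ Ψ C E'
  Ψ-↭ C {E} {E'} E↭E' =
    trans (count-cong (sublists E) (λ S → ok-↭-graph C S E↭E'))
          (count-sublists-↭ (ok C E') (ok-↭-matching C E') E↭E')

  delV-↭ : ∀ z {E E'} → E ↭ E' → delV z E ↭ delV z E'
  delV-↭ z ↭.refl = ↭.refl
  delV-↭ z (↭.prep e E↭E') with incident z e
  ... | true = delV-↭ z E↭E'
  ... | false = ↭.prep e (delV-↭ z E↭E')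
  delV-↭ z (↭.swap e e' E↭E') with incident z e | incident z e'
  ... | true | true = delV-↭ z E↭E'
  ... | true | false = ↭.prep e' (delV-↭ z E↭E')
  ... | false | true = ↭.prep e (delV-↭ z E↭E')
  ... | false | false = ↭.swap e e' (delV-↭ z E↭E')
  delV-↭ z (↭.trans E↭E' E'↭E'') = ↭.trans (delV-↭ z E↭E') (delV-↭ z E'↭E'')

  delIf-↭ : ∀ b z {E E'} → E ↭ E' → delIf b z E ↭ delIf b z E'
  delIf-↭ true z E↭E' = delV-↭ z E↭E'
  delIf-↭ false z E↭E' = E↭E'

  Ψvec-↭ : ∀ C x y i {E E'} → E ↭ E' → Ψvec C E x y i ≡ Ψvec C E' x y i
  Ψvec-↭ C x y i {E} {E'} E↭E' = begin
    Ψvec C E x y i                                         ≡⟨ Ψvec-uniform C E x y i ⟩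
    Ψ (addCover (required i x y) C) (deleted i x y E)
      ≡⟨ Ψ-↭ (addCover (required i x y) C) (delIf-↭ (dropsY i) y (delIf-↭ (dropsX i) x E↭E')) ⟩
    Ψ (addCover (required i x y) C) (deleted i x y E')     ≡⟨ sym (Ψvec-uniform C E' x y i) ⟩
    Ψvec C E' x y i                                        ∎
    where open ≡-Reasoning

module Reversal {V : Set} (_≟_ : DecidableEquality V) where
  open Matching _≟_
  open Permutation _≟_

  incident-swap : ∀ z a b → incident z (a , b) ≡ incident z (b , a)
  incident-swap z a b = ∨-comm (a == z) (b == z)

  sameEdge-swapʳ : ∀ e a b → sameEdge e (a , b) ≡ sameEdge e (b , a)
  sameEdge-swapʳ (c , d) a b = ∨-comm ((c == a) ∧ (d == b)) ((c == b) ∧ (d == a))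

  sameEdge-swapˡ : ∀ a b e → sameEdge (a , b) e ≡ sameEdge (b , a) e
  sameEdge-swapˡ a b (c , d) = tautology 4 (λ ac bd ad bc → (ac ∧ bd) ∨ (ad ∧ bc)) (λ ac bd ad bc → (bc ∧ ad) ∨ (bd ∧ ac))
    ((a == c) ∷ (b == d) ∷ (a == d) ∷ (b == c) ∷ [])

  shareVertex-swapˡ : ∀ a b e → shareVertex (a , b) e ≡ shareVertex (b , a) e
  shareVertex-swapˡ a b e = ∨-comm (incident a e) (incident b e)

  shareVertex-swapʳ : ∀ e a b → shareVertex e (a , b) ≡ shareVertex e (b , a)
  shareVertex-swapʳ (c , d) a b = cong₂ _∨_ (incident-swap c a b) (incident-swap d a b)

  isMatching-swap : ∀ a b S → isMatching ((a , b) ∷ S) ≡ isMatching ((b , a) ∷ S)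
  isMatching-swap a b S = cong (λ x → not x ∧ isMatching S) (anyᵇ-cong S (shareVertex-swapˡ a b))

  ok-swap-matching : ∀ C E a b S → ok C E ((a , b) ∷ S) ≡ ok C E ((b , a) ∷ S)
  ok-swap-matching C E a b S =
    cong₂ _∧_ (isMatching-swap a b S) (cong₂ _∧_
      (allᵇ-cong E (λ e → cong₂ (λ u v → u ∨ not v) (memE-swap e) (isMatching-swap-second e)))
      (cong₂ _∧_ (allᵇ-cong (avoidV C) (λ z → cong not (covers-swap z)))
      (cong₂ _∧_ (allᵇ-cong (avoidE C) (λ e → cong not (memE-swap e)))
      (cong₂ _∧_ (allᵇ-cong (coverV C) covers-swap) (allᵇ-cong (containE C) memE-swap)))))
    where
    covers-swap : ∀ z → covers ((a , b) ∷ S) z ≡ covers ((b , a) ∷ S) z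
    covers-swap z = cong (_∨ covers S z) (incident-swap z a b)
    memE-swap : ∀ e → memE e ((a , b) ∷ S) ≡ memE e ((b , a) ∷ S)
    memE-swap e = cong (_∨ memE e S) (sameEdge-swapʳ e a b)
    isMatching-swap-second : ∀ e → isMatching (e ∷ (a , b) ∷ S) ≡ isMatching (e ∷ (b , a) ∷ S)
    isMatching-swap-second e = cong₂ (λ x y → not x ∧ y)
      (cong (_∨ anyᵇ (shareVertex e) S) (shareVertex-swapʳ e a b)) (isMatching-swap a b S)

  ok-swap-graph : ∀ C a b E S → ok C ((a , b) ∷ E) S ≡ ok C ((b , a) ∷ E) S
  ok-swap-graph C a b E S = cong (λ m → isMatching S ∧ ((m ∧ isMaximal E S) ∧ _))
    (cong₂ (λ u v → u ∨ not (not v ∧ isMatching S)) (anyᵇ-cong S (sameEdge-swapˡ a b)) (anyᵇ-cong S (shareVertex-swapˡ a b)))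

  Ψ-swap : ∀ C a b E → Ψ C ((a , b) ∷ E) ≡ Ψ C ((b , a) ∷ E)
  Ψ-swap C a b E = begin
    Ψ C ((a , b) ∷ E)
      ≡⟨ count-sublists-∷ (ok C ((a , b) ∷ E)) (a , b) E ⟩
    count (ok C ((a , b) ∷ E)) (sublists E) + count (λ S → ok C ((a , b) ∷ E) ((a , b) ∷ S)) (sublists E)
      ≡⟨ cong₂ _+_ (count-cong (sublists E) (ok-swap-graph C a b E))
                   (count-cong (sublists E) (λ S → trans (ok-swap-graph C a b E ((a , b) ∷ S))
                                                          (ok-swap-matching C ((b , a) ∷ E) a b S))) ⟩
    count (ok C ((b , a) ∷ E)) (sublists E) + count (λ S → ok C ((b , a) ∷ E) ((b , a) ∷ S)) (sublists E)
      ≡⟨ sym (count-sublists-∷ (ok C ((b , a) ∷ E)) (b , a) E) ⟩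
    Ψ C ((b , a) ∷ E) ∎
    where open ≡-Reasoning

  Ψ-swap-middle : ∀ C pre a b post → Ψ C (pre ++ (a , b) ∷ post) ≡ Ψ C (pre ++ (b , a) ∷ post)
  Ψ-swap-middle C pre a b post =
    trans (Ψ-↭ C (↭.shift (a , b) pre post))
    (trans (Ψ-swap C a b (pre ++ post)) (sym (Ψ-↭ C (↭.shift (b , a) pre post))))

module Union {V : Set} (_≟_ : DecidableEquality V) where
  open Matching _≟_

  dedup : List (Edge V) → List (Edge V) → List (Edge V)
  dedup E₁ [] = []
  dedup E₁ (e ∷ E) = if memE e E₁ then dedup E₁ E else e ∷ dedup E₁ E

  union≡++dedup : ∀ E₁ E₂ → union E₁ E₂ ≡ E₁ ++ dedup E₁ E₂
  union≡++dedup E₁ [] = refl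
  union≡++dedup E₁ (e ∷ E₂) = cong (λ D → E₁ ++ (if memE e E₁ then D else e ∷ D))
    (List.++-cancelˡ E₁ _ _ (union≡++dedup E₁ E₂))

  dedup-++ : ∀ E₁ E E' → dedup E₁ (E ++ E') ≡ dedup E₁ E ++ dedup E₁ E'
  dedup-++ E₁ [] E' = refl
  dedup-++ E₁ (e ∷ E) E' with memE e E₁
  ... | true = dedup-++ E₁ E E'
  ... | false = cong (e ∷_) (dedup-++ E₁ E E')

  dedup-new : ∀ E₁ {E} → All (λ e → memE e E₁ ≡ false) E → dedup E₁ E ≡ E
  dedup-new E₁ [] = refl
  dedup-new E₁ {e ∷ E} (e∉E₁ ∷ E∉E₁) rewrite e∉E₁ = cong (e ∷_) (dedup-new E₁ E∉E₁)

  dedup-middle : ∀ E₁ pre e post → memE e E₁ ≡ true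
    → All (λ e → memE e E₁ ≡ false) pre → All (λ e → memE e E₁ ≡ false) post
    → dedup E₁ (pre ++ e ∷ post) ≡ pre ++ post
  dedup-middle E₁ pre e post e∈E₁ pre∉E₁ post∉E₁ = begin
    dedup E₁ (pre ++ e ∷ post)             ≡⟨ dedup-++ E₁ pre (e ∷ post) ⟩
    dedup E₁ pre ++ dedup E₁ (e ∷ post)
      ≡⟨ cong₂ _++_ (dedup-new E₁ pre∉E₁) (cong (λ b → if b then dedup E₁ post else e ∷ dedup E₁ post) e∈E₁) ⟩
    pre ++ dedup E₁ post                   ≡⟨ cong (pre ++_) (dedup-new E₁ post∉E₁) ⟩
    pre ++ post ∎
    where open ≡-Reasoning

-- Gluing a small graph to a rest along two vertices

-- dom_ab: every edge of the rest is dominated by t once x (if a) and y (if b) also count as covered.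
record Signature : Set where
  constructor signature
  field
    matching coveredX coveredY : Bool
    dom₀₀ dom₁₀ dom₀₁ dom₁₁ : Bool
open Signature public

dominated : Signature → Bool → Bool → Bool
dominated σ false false = dom₀₀ σ
dominated σ true false = dom₁₀ σ
dominated σ false true = dom₀₁ σ
dominated σ true true = dom₁₁ σ

class : Fin 9 → Signature → Bool
class i σ = not (dropsX i ∧ coveredX σ) ∧ (not (dropsY i ∧ coveredY σ) ∧ (matching σ
  ∧ (dominated σ (dropsX i) (dropsY i) ∧ ((not (needsX i) ∨ coveredX σ) ∧ (not (needsY i) ∨ coveredY σ)))))

module Local {B : Set} (_≟B_ : DecidableEquality B) (bx by : B) where
  open Matching _≟B_

  isPrivate : B → Bool
  isPrivate u = not (u == bx) ∧ not (u == by)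

  coveredOutside : Signature → B → Bool
  coveredOutside σ u = ((u == bx) ∧ coveredX σ) ∨ ((u == by) ∧ coveredY σ)

  coveredWith : Signature → List (Edge B) → B → Bool
  coveredWith σ s u = covers s u ∨ coveredOutside σ u

  -- The conditions of ok for the glued matching that involve the local part s (except that s is a
  -- matching), with the rest entering only through its signature σ.
  localOk : Constraints B → List (Edge B) → Signature → List (Edge B) → Bool
  localOk CS H σ s =
    (matching σ ∧ (allᵇ (λ u → not (coveredWith σ s u)) (avoidV CS) ∧ (allᵇ (λ e → not (memE e s)) (avoidE CS)
      ∧ (allᵇ (coveredWith σ s) (coverV CS) ∧ allᵇ (λ e → memE e s) (containE CS)))))
    ∧ (allᵇ (λ e → not (coveredOutside σ (proj₁ e) ∨ coveredOutside σ (proj₂ e))) s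
    ∧ (dominated σ (covers s bx) (covers s by)
    ∧ allᵇ (λ e → coveredWith σ s (proj₁ e) ∨ coveredWith σ s (proj₂ e)) H))

  localCount : Constraints B → List (Edge B) → Signature → ℕ
  localCount CS H σ = count (λ s → isMatching s ∧ localOk CS H σ s) (sublists H)

  -- ms is bound once so that evaluation by the type checker shares it; writing matchings H twice
  -- makes the exhaustive checks below exponentially slower.
  extendMatchings : Edge B → List (List (Edge B)) → List (List (Edge B))
  extendMatchings e ms = ms ++ map (e ∷_) (filterᵇ (λ s → not (anyᵇ (shareVertex e) s)) ms)

  matchings : List (Edge B) → List (List (Edge B))
  matchings [] = [] ∷ []
  matchings (e ∷ H) = extendMatchings e (matchings H)

  count-filterᵇ : (P Q : List (Edge B) → Bool) (xs : List (List (Edge B))) →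
    count P (filterᵇ Q xs) ≡ count (λ s → Q s ∧ P s) xs
  count-filterᵇ P Q [] = refl
  count-filterᵇ P Q (s ∷ xs) with Q s
  ... | false = count-filterᵇ P Q xs
  ... | true with P s
  ...   | true = cong suc (count-filterᵇ P Q xs)
  ...   | false = count-filterᵇ P Q xs

  count-matchings : (P : List (Edge B) → Bool) (H : List (Edge B)) →
    count (λ s → isMatching s ∧ P s) (sublists H) ≡ count P (matchings H)
  count-matchings P [] with P []
  ... | true = refl
  ... | false = refl
  count-matchings P (e ∷ H) = begin
    count (λ s → isMatching s ∧ P s) (sublists (e ∷ H))
      ≡⟨ count-sublists-∷ _ e H ⟩
    count (λ s → isMatching s ∧ P s) (sublists H) + count (λ s → isMatching (e ∷ s) ∧ P (e ∷ s)) (sublists H)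
      ≡⟨ cong₂ _+_ (count-matchings P H) (trans (count-cong (sublists H) reassociate) (count-matchings Pₑ H)) ⟩
    count P (matchings H) + count Pₑ (matchings H)
      ≡⟨ cong (count P (matchings H) +_) (sym (trans (count-map P (e ∷_) (filterᵇ disjoint (matchings H)))
                                                       (count-filterᵇ (λ s → P (e ∷ s)) disjoint (matchings H)))) ⟩
    count P (matchings H) + count P (map (e ∷_) (filterᵇ disjoint (matchings H)))
      ≡⟨ sym (count-++ P (matchings H) _) ⟩
    count P (matchings (e ∷ H)) ∎
    where
    open ≡-Reasoning
    disjoint Pₑ : List (Edge B) → Bool
    disjoint s = not (anyᵇ (shareVertex e) s)
    Pₑ s = disjoint s ∧ P (e ∷ s)
    reassociate : ∀ s → isMatching (e ∷ s) ∧ P (e ∷ s) ≡ isMatching s ∧ Pₑ s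
    reassociate s = tautology 3 (λ a b c → (not a ∧ b) ∧ c) (λ a b c → b ∧ (not a ∧ c))
      (anyᵇ (shareVertex e) s ∷ isMatching s ∷ P (e ∷ s) ∷ [])

  localCountByMatchings : Constraints B → List (Edge B) → Signature → ℕ
  localCountByMatchings CS H σ = count (localOk CS H σ) (matchings H)

  localCount-matchings : ∀ CS H σ → localCount CS H σ ≡ localCountByMatchings CS H σ
  localCount-matchings CS H σ = count-matchings (localOk CS H σ) H

module RestSide {V : Set} (_≟_ : DecidableEquality V) (R : List (Edge V)) (x y : V) where
  open Matching _≟_
  open MatchingFacts _≟_
  open IndexShape _≟_

  dominatedWith : Bool → Bool → List (Edge V) → Bool
  dominatedWith a b t = allᵇ (λ e → (a ∧ incident x e) ∨ ((b ∧ incident y e) ∨ dominates t e)) R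

  signatureOf : List (Edge V) → Signature
  signatureOf t = signature (isMatching t) (covers t x) (covers t y)
    (dominatedWith false false t) (dominatedWith true false t) (dominatedWith false true t) (dominatedWith true true t)

  dominated-signatureOf : ∀ t a b → dominated (signatureOf t) a b ≡ dominatedWith a b t
  dominated-signatureOf t false false = refl
  dominated-signatureOf t true false = refl
  dominated-signatureOf t false true = refl
  dominated-signatureOf t true true = refl

  restSide : ∀ C i → Ψvec C R x y i
    ≡ sumOver (λ t → indicator (satisfies C t) * indicator (class i (signatureOf t))) (sublists R)
  restSide C@(cons a b c d) i = begin
    Ψvec C R x y i
      ≡⟨ Ψvec-uniform C R x y i ⟩
    count (ok C' (deleted i x y R)) (sublists (delIf (dropsY i) y (delIf (dropsX i) x R)))
      ≡⟨ count-sublists-delIf (dropsY i) y _ _ ⟩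
    count (λ t → not (dropsY i ∧ covers t y) ∧ ok C' (deleted i x y R) t) (sublists (delIf (dropsX i) x R))
      ≡⟨ count-sublists-delIf (dropsX i) x _ R ⟩
    count (λ t → not (dropsX i ∧ covers t x) ∧ (not (dropsY i ∧ covers t y) ∧ ok C' (deleted i x y R) t)) (sublists R)
      ≡⟨ count-cong (sublists R) classify ⟩
    count (λ t → class i (signatureOf t) ∧ satisfies C t) (sublists R)
      ≡⟨ count≡sumOver _ (sublists R) ⟩
    sumOver (λ t → indicator (class i (signatureOf t) ∧ satisfies C t)) (sublists R)
      ≡⟨ sumOver-cong (sublists R) (λ t → indicator-∧ (class i (signatureOf t)) (satisfies C t)) ⟩
    sumOver (λ t → indicator (satisfies C t) * indicator (class i (signatureOf t))) (sublists R) ∎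
    where
    open ≡-Reasoning
    C' : Constraints V
    C' = addCover (required i x y) C
    covered-required : ∀ t → allᵇ (covers t) (required i x y ++ c)
      ≡ ((not (needsX i) ∨ covers t x) ∧ (not (needsY i) ∨ covers t y)) ∧ allᵇ (covers t) c
    covered-required t = trans (allᵇ-++ (covers t) (required i x y) c) (cong (_∧ allᵇ (covers t) c)
      (trans (allᵇ-++ (covers t) (optional (needsX i) x) (optional (needsY i) y))
             (cong₂ _∧_ (allᵇ-optional (covers t) (needsX i) x) (allᵇ-optional (covers t) (needsY i) y))))
    dominated-deleted : ∀ t → allᵇ (dominates t) (deleted i x y R) ≡ dominated (signatureOf t) (dropsX i) (dropsY i)
    dominated-deleted t = trans (allᵇ-delIf (dropsY i) y (dominates t) _)
      (trans (allᵇ-delIf (dropsX i) x _ R) (sym (dominated-signatureOf t (dropsX i) (dropsY i))))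
    classify : ∀ t → not (dropsX i ∧ covers t x) ∧ (not (dropsY i ∧ covers t y) ∧ ok C' (deleted i x y R) t)
      ≡ class i (signatureOf t) ∧ satisfies C t
    classify t
      rewrite ok≡dominates C' (deleted i x y R) t | dominated-deleted t | covered-required t =
      tautology 12
        (λ dx dy nx ny cx cy m D av ae cv ce →
          not (dx ∧ cx) ∧ (not (dy ∧ cy) ∧ (m ∧ (D ∧ (av ∧ (ae ∧ ((((not nx ∨ cx) ∧ (not ny ∨ cy)) ∧ cv) ∧ ce)))))))
        (λ dx dy nx ny cx cy m D av ae cv ce →
          (not (dx ∧ cx) ∧ (not (dy ∧ cy) ∧ (m ∧ (D ∧ ((not nx ∨ cx) ∧ (not ny ∨ cy)))))) ∧ (av ∧ (ae ∧ (cv ∧ ce))))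
        (dropsX i ∷ dropsY i ∷ needsX i ∷ needsY i ∷ covers t x ∷ covers t y ∷ isMatching t
          ∷ dominated (signatureOf t) (dropsX i) (dropsY i)
          ∷ allᵇ (λ z → not (covers t z)) a ∷ allᵇ (λ e → not (memE e t)) b ∷ allᵇ (covers t) c
          ∷ allᵇ (λ e → memE e t) d ∷ [])

-- The small graph H on B meets the rest R only in x = ι bx and y = ι by.  The constraints split
-- into CS on H, whose edge constraints start at a private vertex of H, and CR on vertices far from H.
module Gluing {V : Set} (_≟_ : DecidableEquality V) {B : Set} (_≟B_ : DecidableEquality B)
    (ι : B → V) (ι-injective : ∀ {u v} → ι u ≡ ι v → u ≡ v) (bx by : B)
    (bx≢by : Matching._==_ _≟B_ bx by ≡ false) (R : List (Edge V)) where
  open Matching _≟_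
  open MatchingFacts _≟_
  private
    module MB = Matching _≟B_
    module FB = MatchingFacts _≟B_
    module Rι = Renaming _≟B_ _≟_ ι ι-injective
  open Local _≟B_ bx by public

  x y : V
  x = ι bx
  y = ι by

  open RestSide _≟_ R x y public

  Fresh Far : V → Set
  Fresh z = ∀ u → isPrivate u ≡ true → (ι u == z) ≡ false
  Far z = ∀ u → (ι u == z) ≡ false

  FreshEdge : Edge V → Set
  FreshEdge e = ∀ u → isPrivate u ≡ true → incident (ι u) e ≡ false

  fresh-endpoints : ∀ {a b} → FreshEdge (a , b) → Fresh a × Fresh b
  fresh-endpoints {a} {b} fe =
      (λ u pu → trans (==-sym (ι u) a) (∨-conicalˡ _ _ (fe u pu)))
    , (λ u pu → trans (==-sym (ι u) b) (∨-conicalʳ _ _ (fe u pu)))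

  PrivateEdges : Constraints B → Set
  PrivateEdges CS = All (λ e → isPrivate (proj₁ e) ≡ true) (avoidE CS) × All (λ e → isPrivate (proj₁ e) ≡ true) (containE CS)

  FarConstraints : Constraints V → Set
  FarConstraints CR = All Far (avoidV CR) × All (λ e → Far (proj₁ e)) (avoidE CR)
                    × All Far (coverV CR) × All (λ e → Far (proj₁ e)) (containE CR)

  through-interface : (F : V → Bool) → (∀ u → isPrivate u ≡ true → F (ι u) ≡ false)
    → ∀ u → F (ι u) ≡ ((u MB.== bx) ∧ F x) ∨ ((u MB.== by) ∧ F y)
  through-interface F h u with u MB.== bx in u≡bx
  ... | true rewrite FB.==⇒≡ u≡bx | bx≢by = sym (∨-identityʳ (F x))
  ... | false with u MB.== by in u≡by
  ...   | true rewrite FB.==⇒≡ u≡by = refl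
  ...   | false = h u (cong₂ (λ a b → not a ∧ not b) u≡bx u≡by)

  covers-rest : ∀ t → All FreshEdge t → ∀ u → covers t (ι u) ≡ coveredOutside (signatureOf t) u
  covers-rest t ft = through-interface (covers t)
    (λ u pu → anyᵇ-false-local (All.map (λ fe → fe u pu) ft))

  covers-local-fresh : ∀ s₀ z → Fresh z
    → covers (mapEdges ι s₀) z ≡ ((x == z) ∧ MB.covers s₀ bx) ∨ ((y == z) ∧ MB.covers s₀ by)
  covers-local-fresh s₀ z fz = begin
    covers (mapEdges ι s₀) z
      ≡⟨ anyᵇ-map (incident z) (mapEdge ι) s₀ ⟩
    anyᵇ (λ e → incident z (mapEdge ι e)) s₀
      ≡⟨ anyᵇ-cong s₀ through ⟩
    anyᵇ (λ e → ((x == z) ∧ MB.incident bx e) ∨ ((y == z) ∧ MB.incident by e)) s₀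
      ≡⟨ anyᵇ-∨ (λ e → (x == z) ∧ MB.incident bx e) (λ e → (y == z) ∧ MB.incident by e) s₀ ⟩
    anyᵇ (λ e → (x == z) ∧ MB.incident bx e) s₀ ∨ anyᵇ (λ e → (y == z) ∧ MB.incident by e) s₀
      ≡⟨ cong₂ _∨_ (anyᵇ-∧ˡ (x == z) (MB.incident bx) s₀) (anyᵇ-∧ˡ (y == z) (MB.incident by) s₀) ⟩
    ((x == z) ∧ MB.covers s₀ bx) ∨ ((y == z) ∧ MB.covers s₀ by) ∎
    where
    open ≡-Reasoning
    through : ∀ e → incident z (mapEdge ι e) ≡ ((x == z) ∧ MB.incident bx e) ∨ ((y == z) ∧ MB.incident by e)
    through (a , b) rewrite through-interface (_== z) fz a | through-interface (_== z) fz b =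
      tautology 6 (λ a₁ xz a₂ yz b₁ b₂ → ((a₁ ∧ xz) ∨ (a₂ ∧ yz)) ∨ ((b₁ ∧ xz) ∨ (b₂ ∧ yz)))
                  (λ a₁ xz a₂ yz b₁ b₂ → (xz ∧ (a₁ ∨ b₁)) ∨ (yz ∧ (a₂ ∨ b₂)))
        ((a MB.== bx) ∷ (x == z) ∷ (a MB.== by) ∷ (y == z) ∷ (b MB.== bx) ∷ (b MB.== by) ∷ [])

  covers-local-far : ∀ s₀ z → Far z → covers (mapEdges ι s₀) z ≡ false
  covers-local-far s₀ z fz = trans (anyᵇ-map (incident z) (mapEdge ι) s₀)
    (anyᵇ-false _ s₀ (λ { (a , b) → cong₂ _∨_ (fz a) (fz b) }))

  memE-rest-private : ∀ t → All FreshEdge t → ∀ u z → isPrivate u ≡ true → memE (ι u , z) t ≡ false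
  memE-rest-private t ft u z pu = anyᵇ-false-local (All.map (λ {e} fe → not-same e fe) ft)
    where
    not-same : ∀ e → FreshEdge e → sameEdge (ι u , z) e ≡ false
    not-same (a , b) fe rewrite proj₁ (fresh-endpoints fe) u pu | proj₂ (fresh-endpoints fe) u pu = refl

  memE-local-far : ∀ s₀ z z' → Far z → memE (z , z') (mapEdges ι s₀) ≡ false
  memE-local-far s₀ z z' fz = trans (anyᵇ-map (sameEdge (z , z')) (mapEdge ι) s₀) (anyᵇ-false _ s₀ not-same)
    where
    not-same : ∀ e → sameEdge (z , z') (mapEdge ι e) ≡ false
    not-same (a , b) rewrite ==-sym z (ι a) | ==-sym z (ι b) | fz a | fz b = refl

  covers-glued : ∀ s₀ t → All FreshEdge t → ∀ u → covers (mapEdges ι s₀ ++ t) (ι u) ≡ coveredWith (signatureOf t) s₀ u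
  covers-glued s₀ t ft u = trans (covers-++ (mapEdges ι s₀) t (ι u)) (cong₂ _∨_ (Rι.covers-rename s₀ u) (covers-rest t ft u))

  covers-glued-far : ∀ s₀ t z → Far z → covers (mapEdges ι s₀ ++ t) z ≡ covers t z
  covers-glued-far s₀ t z fz = trans (covers-++ (mapEdges ι s₀) t z) (cong (_∨ covers t z) (covers-local-far s₀ z fz))

  memE-glued : ∀ s₀ t → All FreshEdge t → ∀ e → isPrivate (proj₁ e) ≡ true
    → memE (mapEdge ι e) (mapEdges ι s₀ ++ t) ≡ MB.memE e s₀
  memE-glued s₀ t ft (u , u') pu = trans (memE-++ _ (mapEdges ι s₀) t)
    (trans (cong₂ _∨_ (Rι.memE-rename (u , u') s₀) (memE-rest-private t ft u (ι u') pu)) (∨-identityʳ _))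

  memE-glued-far : ∀ s₀ t e → Far (proj₁ e) → memE e (mapEdges ι s₀ ++ t) ≡ memE e t
  memE-glued-far s₀ t (z , z') fz = trans (memE-++ _ (mapEdges ι s₀) t) (cong (_∨ memE (z , z') t) (memE-local-far s₀ z z' fz))

  dominates-glued-rest : ∀ s₀ t e → FreshEdge e → dominates (mapEdges ι s₀ ++ t) e
    ≡ (MB.covers s₀ bx ∧ incident x e) ∨ ((MB.covers s₀ by ∧ incident y e) ∨ dominates t e)
  dominates-glued-rest s₀ t (a , b) fe
    rewrite covers-++ (mapEdges ι s₀) t a | covers-++ (mapEdges ι s₀) t b
          | covers-local-fresh s₀ a (proj₁ (fresh-endpoints fe)) | covers-local-fresh s₀ b (proj₂ (fresh-endpoints fe))
          | ==-sym a x | ==-sym b x | ==-sym a y | ==-sym b y =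
    tautology 8 (λ xa ya xb yb cx cy ta tb → (((xa ∧ cx) ∨ (ya ∧ cy)) ∨ ta) ∨ (((xb ∧ cx) ∨ (yb ∧ cy)) ∨ tb))
                (λ xa ya xb yb cx cy ta tb → (cx ∧ (xa ∨ xb)) ∨ ((cy ∧ (ya ∨ yb)) ∨ (ta ∨ tb)))
      ((x == a) ∷ (y == a) ∷ (x == b) ∷ (y == b) ∷ MB.covers s₀ bx ∷ MB.covers s₀ by ∷ covers t a ∷ covers t b ∷ [])

  allᵇ-dominates-rest : All FreshEdge R → ∀ s₀ t
    → allᵇ (dominates (mapEdges ι s₀ ++ t)) R ≡ dominated (signatureOf t) (MB.covers s₀ bx) (MB.covers s₀ by)
  allᵇ-dominates-rest fR s₀ t =
    trans (allᵇ-cong-local (All.map (λ {e} fe → dominates-glued-rest s₀ t e fe) fR))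
          (sym (dominated-signatureOf t (MB.covers s₀ bx) (MB.covers s₀ by)))

  allᵇ-dominates-local : ∀ H s₀ t → All FreshEdge t → allᵇ (dominates (mapEdges ι s₀ ++ t)) (mapEdges ι H)
    ≡ allᵇ (λ e → coveredWith (signatureOf t) s₀ (proj₁ e) ∨ coveredWith (signatureOf t) s₀ (proj₂ e)) H
  allᵇ-dominates-local H s₀ t ft = trans (allᵇ-map _ (mapEdge ι) H)
    (allᵇ-cong H (λ { (u , u') → cong₂ _∨_ (covers-glued s₀ t ft u) (covers-glued s₀ t ft u') }))

  isMatching-glued : ∀ s₀ t → All FreshEdge t → isMatching (mapEdges ι s₀ ++ t)
    ≡ MB.isMatching s₀ ∧ (isMatching t
        ∧ allᵇ (λ e → not (coveredOutside (signatureOf t) (proj₁ e) ∨ coveredOutside (signatureOf t) (proj₂ e))) s₀)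
  isMatching-glued s₀ t ft = trans (isMatching-++ (mapEdges ι s₀) t)
    (cong₂ _∧_ (Rι.isMatching-rename s₀) (cong (isMatching t ∧_) (trans (allᵇ-map _ (mapEdge ι) s₀) (allᵇ-cong s₀ disjoint))))
    where
    disjoint : ∀ e → not (anyᵇ (shareVertex (mapEdge ι e)) t)
      ≡ not (coveredOutside (signatureOf t) (proj₁ e) ∨ coveredOutside (signatureOf t) (proj₂ e))
    disjoint (u , u') = cong not (trans (shares≡dominates (ι u , ι u') t) (cong₂ _∨_ (covers-rest t ft u) (covers-rest t ft u')))

  ok-glued : ∀ CS CR H → All FreshEdge R → PrivateEdges CS → FarConstraints CR → ∀ s₀ t → All FreshEdge t
    → ok (mapConstraints ι CS ⊕ CR) (mapEdges ι H ++ R) (mapEdges ι s₀ ++ t)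
      ≡ (MB.isMatching s₀ ∧ localOk CS H (signatureOf t) s₀) ∧ satisfies CR t
  ok-glued (cons a b c d) (cons a' b' c' d') H fR (pb , pd) (fa' , fb' , fc' , fd') s₀ t ft =
    trans (∧-cong-if (isMatching-glued s₀ t ft) (λ m → cong₂ _∧_ (maximal m)
            (cong₂ _∧_ avoided-vertices (cong₂ _∧_ avoided-edges (cong₂ _∧_ covered-vertices contained-edges)))))
    (tautology 13
      (λ m₀ m dj dH dR av av' ae ae' cv cv' ce ce' →
        (m₀ ∧ (m ∧ dj)) ∧ ((dH ∧ dR) ∧ ((av ∧ av') ∧ ((ae ∧ ae') ∧ ((cv ∧ cv') ∧ (ce ∧ ce'))))))
      (λ m₀ m dj dH dR av av' ae ae' cv cv' ce ce' →
        (m₀ ∧ ((m ∧ (av ∧ (ae ∧ (cv ∧ ce)))) ∧ (dj ∧ (dR ∧ dH)))) ∧ (av' ∧ (ae' ∧ (cv' ∧ ce'))))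
      (MB.isMatching s₀ ∷ isMatching t
        ∷ allᵇ (λ e → not (coveredOutside σ (proj₁ e) ∨ coveredOutside σ (proj₂ e))) s₀
        ∷ allᵇ (λ e → coveredWith σ s₀ (proj₁ e) ∨ coveredWith σ s₀ (proj₂ e)) H
        ∷ dominated σ (MB.covers s₀ bx) (MB.covers s₀ by)
        ∷ allᵇ (λ u → not (coveredWith σ s₀ u)) a ∷ allᵇ (λ z → not (covers t z)) a'
        ∷ allᵇ (λ e → not (MB.memE e s₀)) b ∷ allᵇ (λ e → not (memE e t)) b'
        ∷ allᵇ (coveredWith σ s₀) c ∷ allᵇ (covers t) c'
        ∷ allᵇ (λ e → MB.memE e s₀) d ∷ allᵇ (λ e → memE e t) d' ∷ []))
    where
    S : List (Edge V)
    S = mapEdges ι s₀ ++ t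
    σ : Signature
    σ = signatureOf t
    maximal : isMatching S ≡ true → isMaximal (mapEdges ι H ++ R) S
      ≡ allᵇ (λ e → coveredWith σ s₀ (proj₁ e) ∨ coveredWith σ s₀ (proj₂ e)) H ∧ dominated σ (MB.covers s₀ bx) (MB.covers s₀ by)
    maximal m = trans (isMaximal≡dominates (mapEdges ι H ++ R) S m)
      (trans (allᵇ-++ _ (mapEdges ι H) R) (cong₂ _∧_ (allᵇ-dominates-local H s₀ t ft) (allᵇ-dominates-rest fR s₀ t)))
    avoided-vertices : allᵇ (λ z → not (covers S z)) (map ι a ++ a')
      ≡ allᵇ (λ u → not (coveredWith σ s₀ u)) a ∧ allᵇ (λ z → not (covers t z)) a'
    avoided-vertices = trans (allᵇ-++ _ (map ι a) a') (cong₂ _∧_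
      (trans (allᵇ-map _ ι a) (allᵇ-cong a (λ u → cong not (covers-glued s₀ t ft u))))
      (allᵇ-cong-local (All.map (λ {z} fz → cong not (covers-glued-far s₀ t z fz)) fa')))
    avoided-edges : allᵇ (λ e → not (memE e S)) (mapEdges ι b ++ b')
      ≡ allᵇ (λ e → not (MB.memE e s₀)) b ∧ allᵇ (λ e → not (memE e t)) b'
    avoided-edges = trans (allᵇ-++ _ (mapEdges ι b) b') (cong₂ _∧_
      (trans (allᵇ-map _ (mapEdge ι) b) (allᵇ-cong-local (All.map (λ {e} pe → cong not (memE-glued s₀ t ft e pe)) pb)))
      (allᵇ-cong-local (All.map (λ {e} fe → cong not (memE-glued-far s₀ t e fe)) fb')))
    covered-vertices : allᵇ (covers S) (map ι c ++ c') ≡ allᵇ (coveredWith σ s₀) c ∧ allᵇ (covers t) c'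
    covered-vertices = trans (allᵇ-++ _ (map ι c) c') (cong₂ _∧_
      (trans (allᵇ-map _ ι c) (allᵇ-cong c (covers-glued s₀ t ft)))
      (allᵇ-cong-local (All.map (λ {z} fz → covers-glued-far s₀ t z fz) fc')))
    contained-edges : allᵇ (λ e → memE e S) (mapEdges ι d ++ d') ≡ allᵇ (λ e → MB.memE e s₀) d ∧ allᵇ (λ e → memE e t) d'
    contained-edges = trans (allᵇ-++ _ (mapEdges ι d) d') (cong₂ _∧_
      (trans (allᵇ-map _ (mapEdge ι) d) (allᵇ-cong-local (All.map (λ {e} pe → memE-glued s₀ t ft e pe) pd)))
      (allᵇ-cong-local (All.map (λ {e} fe → memE-glued-far s₀ t e fe) fd')))

  Ψ-glued : ∀ CS CR H → All FreshEdge R → PrivateEdges CS → FarConstraints CR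
    → Ψ (mapConstraints ι CS ⊕ CR) (mapEdges ι H ++ R)
      ≡ sumOver (λ t → indicator (satisfies CR t) * localCount CS H (signatureOf t)) (sublists R)
  Ψ-glued CS CR H fR pCS fCR = begin
    count (ok C E) (sublists (mapEdges ι H ++ R))
      ≡⟨ count-sublists-++ (ok C E) (mapEdges ι H) R ⟩
    sumOver glue (sublists (mapEdges ι H))
      ≡⟨ cong (sumOver glue) (sublists-map (mapEdge ι) H) ⟩
    sumOver glue (map (mapEdges ι) (sublists H))
      ≡⟨ sumOver-map glue (mapEdges ι) (sublists H) ⟩
    sumOver (λ s₀ → glue (mapEdges ι s₀)) (sublists H)
      ≡⟨ sumOver-cong (sublists H) split ⟩
    sumOver (λ s₀ → sumOver (λ t → indicator (L s₀ t ∧ satisfies CR t)) (sublists R)) (sublists H)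
      ≡⟨ sumOver-swap (λ s₀ t → indicator (L s₀ t ∧ satisfies CR t)) (sublists H) (sublists R) ⟩
    sumOver (λ t → sumOver (λ s₀ → indicator (L s₀ t ∧ satisfies CR t)) (sublists H)) (sublists R)
      ≡⟨ sumOver-cong (sublists R) factor ⟩
    sumOver (λ t → indicator (satisfies CR t) * localCount CS H (signatureOf t)) (sublists R) ∎
    where
    open ≡-Reasoning
    C : Constraints V
    C = mapConstraints ι CS ⊕ CR
    E : List (Edge V)
    E = mapEdges ι H ++ R
    glue : List (Edge V) → ℕ
    glue s = count (λ t → ok C E (s ++ t)) (sublists R)
    L : List (Edge B) → List (Edge V) → Bool
    L s₀ t = MB.isMatching s₀ ∧ localOk CS H (signatureOf t) s₀
    split : ∀ s₀ → glue (mapEdges ι s₀) ≡ sumOver (λ t → indicator (L s₀ t ∧ satisfies CR t)) (sublists R)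
    split s₀ = trans (count-cong-local (All.map (λ {t} ft → ok-glued CS CR H fR pCS fCR s₀ t ft) (All-sublists fR)))
                     (count≡sumOver _ (sublists R))
    factor : ∀ t → sumOver (λ s₀ → indicator (L s₀ t ∧ satisfies CR t)) (sublists H)
      ≡ indicator (satisfies CR t) * localCount CS H (signatureOf t)
    factor t = trans (sumOver-cong (sublists H) (λ s₀ → indicator-∧ (L s₀ t) (satisfies CR t)))
      (trans (sumOver-*ˡ (indicator (satisfies CR t)) (λ s₀ → indicator (L s₀ t)) (sublists H))
             (cong (indicator (satisfies CR t) *_) (sym (count≡sumOver (λ s₀ → L s₀ t) (sublists H)))))

  transfer : ∀ CS CR H (T : Fin 9 → ℕ) → All FreshEdge R → PrivateEdges CS → FarConstraints CR
    → (∀ σ → localCount CS H σ ≡ sumFin 9 (λ l → T l * indicator (class l σ)))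
    → Ψ (mapConstraints ι CS ⊕ CR) (mapEdges ι H ++ R) ≡ sumFin 9 (λ l → T l * Ψvec CR R x y l)
  transfer CS CR H T fR pCS fCR table = begin
    Ψ (mapConstraints ι CS ⊕ CR) (mapEdges ι H ++ R)
      ≡⟨ Ψ-glued CS CR H fR pCS fCR ⟩
    sumOver (λ t → indicator (satisfies CR t) * localCount CS H (signatureOf t)) (sublists R)
      ≡⟨ sumOver-cong (sublists R) (λ t → cong (indicator (satisfies CR t) *_) (table (signatureOf t))) ⟩
    sumOver (λ t → indicator (satisfies CR t) * sumFin 9 (λ l → T l * indicator (class l (signatureOf t)))) (sublists R)
      ≡⟨ sumOver-*-sumFin 9 (λ t → indicator (satisfies CR t)) T (λ l t → indicator (class l (signatureOf t))) (sublists R) ⟩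
    sumFin 9 (λ l → T l * sumOver (λ t → indicator (satisfies CR t) * indicator (class l (signatureOf t))) (sublists R))
      ≡⟨ sumFin-cong 9 (λ l → cong (T l *_) (sym (restSide CR l))) ⟩
    sumFin 9 (λ l → T l * Ψvec CR R x y l) ∎
    where open ≡-Reasoning

  private
    module SV = IndexShape _≟_
    module SB = IndexShape _≟B_

  delIf-glued : ∀ b u → isPrivate u ≡ true → All FreshEdge R → ∀ H
    → SV.delIf b (ι u) (mapEdges ι H ++ R) ≡ mapEdges ι (SB.delIf b u H) ++ R
  delIf-glued false u pu fR H = refl
  delIf-glued true u pu fR H =
    trans (delV-++ (ι u) (mapEdges ι H) R)
          (cong₂ _++_ (Rι.delV-rename u H) (delV-fresh (ι u) (All.map (λ fe → fe u pu) fR)))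

  Ψvec-glued : ∀ CS CR H a b → isPrivate a ≡ true → isPrivate b ≡ true → All FreshEdge R → ∀ i
    → Ψvec (mapConstraints ι CS ⊕ CR) (mapEdges ι H ++ R) (ι a) (ι b) i
      ≡ Ψ (mapConstraints ι (addCover (required i a b) CS) ⊕ CR) (mapEdges ι (SB.deleted i a b H) ++ R)
  Ψvec-glued CS@(cons a₀ b₀ c₀ d₀) CR@(cons a' b' c' d') H a b pa pb fR i =
    trans (SV.Ψvec-uniform (mapConstraints ι CS ⊕ CR) (mapEdges ι H ++ R) (ι a) (ι b) i)
          (cong₂ Ψ (cong (λ r → cons (map ι a₀ ++ a') (mapEdges ι b₀ ++ b') r (mapEdges ι d₀ ++ d')) required-vertices)
                   deleted-vertices)
    where
    required-vertices : required i (ι a) (ι b) ++ (map ι c₀ ++ c') ≡ map ι (required i a b ++ c₀) ++ c'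
    required-vertices = trans (sym (List.++-assoc (required i (ι a) (ι b)) (map ι c₀) c'))
      (cong (_++ c') (trans (cong (_++ map ι c₀) (sym (map-required ι i a b))) (sym (List.map-++ ι (required i a b) c₀))))
    deleted-vertices : SV.deleted i (ι a) (ι b) (mapEdges ι H ++ R) ≡ mapEdges ι (SB.deleted i a b H) ++ R
    deleted-vertices = trans (cong (SV.delIf (dropsY i) (ι b)) (delIf-glued (dropsX i) a pa fR H))
                             (delIf-glued (dropsY i) b pb fR (SB.delIf (dropsX i) a H))

  transfer-Ψvec : ∀ CS CR H a b (T : Fin 9 → Fin 9 → ℕ) → isPrivate a ≡ true → isPrivate b ≡ true
    → All FreshEdge R → PrivateEdges CS → FarConstraints CR
    → (∀ i σ → localCount (addCover (required i a b) CS) (SB.deleted i a b H) σ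
               ≡ sumFin 9 (λ l → T i l * indicator (class l σ)))
    → ∀ i → Ψvec (mapConstraints ι CS ⊕ CR) (mapEdges ι H ++ R) (ι a) (ι b) i ≡ sumFin 9 (λ l → T i l * Ψvec CR R x y l)
  transfer-Ψvec CS@(cons _ _ _ _) CR H a b T pa pb fR pCS fCR table i =
    trans (Ψvec-glued CS CR H a b pa pb fR i)
          (transfer (addCover (required i a b) CS) CR (SB.deleted i a b H) (T i) fR pCS fCR (table i))

-- Exhaustive computations for one and for two hexagons

data Turn : ℕ → Set where
  left : Turn 1
  straight : Turn 2
  right : Turn 3

toTurn : ∀ x → 1 ≤ x × x ≤ 3 → Turn x
toTurn 1 _ = left
toTurn 2 _ = straight
toTurn 3 _ = right
toTurn (suc (suc (suc (suc x)))) (_ , s≤s (s≤s (s≤s ())))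

allFin? : ∀ n → (Fin n → Bool) → Bool
allFin? zero f = true
allFin? (suc n) f = f zero ∧ allFin? n (λ i → f (suc i))

allFin?-sound : ∀ n (f : Fin n → Bool) → allFin? n f ≡ true → ∀ i → f i ≡ true
allFin?-sound (suc n) f h zero = ∧-conicalˡ (f zero) _ h
allFin?-sound (suc n) f h (suc i) = allFin?-sound n (λ i → f (suc i)) (∧-conicalʳ (f zero) _ h) i

allSignatures? : (Signature → Bool) → Bool
allSignatures? P = sameTruthTable 7 (λ m cx cy d₀₀ d₁₀ d₀₁ d₁₁ → P (signature m cx cy d₀₀ d₁₀ d₀₁ d₁₁))
                                    (λ _ _ _ _ _ _ _ → true)

allSignatures?-sound : ∀ P → allSignatures? P ≡ true → ∀ σ → P σ ≡ true
allSignatures?-sound P h (signature m cx cy d₀₀ d₁₀ d₀₁ d₁₁) =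
  tautology 7 (λ m cx cy d₀₀ d₁₀ d₀₁ d₁₁ → P (signature m cx cy d₀₀ d₁₀ d₀₁ d₁₁)) (λ _ _ _ _ _ _ _ → true)
    {Equivalence.from T-≡ h} (m ∷ cx ∷ cy ∷ d₀₀ ∷ d₁₀ ∷ d₀₁ ∷ d₁₁ ∷ [])

byComputation : (f g : Fin 9 → Signature → ℕ) → allFin? 9 (λ i → allSignatures? (λ σ → f i σ ≡ᵇ g i σ)) ≡ true
  → ∀ i σ → f i σ ≡ g i σ
byComputation f g h i σ =
  ≡ᵇ⇒≡ (f i σ) (g i σ) (Equivalence.from T-≡ (allSignatures?-sound (λ σ → f i σ ≡ᵇ g i σ)
    (allFin?-sound 9 (λ i → allSignatures? (λ σ → f i σ ≡ᵇ g i σ)) h i) σ))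

hexagonSides : ∀ {n} → (Fin n → ℕ) → Fin n → List (Edge (HV n))
hexagonSides k i = pathEdges (qPath k i) ++ pathEdges (pPath k i)

sides : ∀ n → (Fin n → ℕ) → List (Edge (HV n))
sides n k = concatMap (hexagonSides k) (allFin n)

-- The edge p 1 q 1 is left to the rest of the chain.
openHexagon : ℕ → List (Edge (HV 1))
openHexagon k₀ = (p zero , q zero) ∷ hexagonSides (λ _ → k₀) zero

module Hexagon = Local (_≟HV_ {1}) (q (suc zero)) (p (suc zero))
module HexagonShape = IndexShape (_≟HV_ {1})

hexagonConstraints : Fin 9 → Constraints (HV 1)
hexagonConstraints i = addCover (required i (q zero) (p zero)) noConstraints

hexagonEdges : ℕ → Fin 9 → List (Edge (HV 1))
hexagonEdges k₀ i = HexagonShape.deleted i (q zero) (p zero) (openHexagon k₀)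

hexagonTable : ∀ {k₀} → Turn k₀ → ∀ i σ →
  Hexagon.localCount (hexagonConstraints i) (hexagonEdges k₀ i) σ ≡ sumFin 9 (λ l → kMat k₀ i l * indicator (class l σ))
hexagonTable {k₀} t i σ = trans (Hexagon.localCount-matchings (hexagonConstraints i) (hexagonEdges k₀ i) σ) (table t i σ)
  where
  enumerated expected : ℕ → Fin 9 → Signature → ℕ
  enumerated k₀ i σ = Hexagon.localCountByMatchings (hexagonConstraints i) (hexagonEdges k₀ i) σ
  expected k₀ i σ = sumFin 9 (λ l → kMat k₀ i l * indicator (class l σ))
  table : ∀ {k₀} → Turn k₀ → ∀ i σ → enumerated k₀ i σ ≡ expected k₀ i σ
  table left = byComputation (enumerated 1) (expected 1) refl
  table straight = byComputation (enumerated 2) (expected 2) refl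
  table right = byComputation (enumerated 3) (expected 3) refl

-- The edge p 2 q 2, which is dc, is left to K.
twoHexagons : (Fin 2 → ℕ) → List (Edge (HV 2))
twoHexagons k = (p zero , q zero) ∷ (p (suc zero) , q (suc zero)) ∷ sides 2 k

lastConstraints : ∀ {n} → (Fin n → ℕ) → Constraints (HV n)
lastConstraints {n} k = cons (vE n k ∷ []) ((vE n k , vD n) ∷ (vF n k , vC n) ∷ []) (vF n k ∷ []) []

module TwoHexagons = Local (_≟HV_ {2}) (q (suc (suc zero))) (p (suc (suc zero)))
module TwoHexagonShape = IndexShape (_≟HV_ {2})

twoHexagonConstraints : (Fin 2 → ℕ) → Fin 9 → Constraints (HV 2)
twoHexagonConstraints k i = addCover (required i (q zero) (p zero)) (lastConstraints k)

twoHexagonEdges : (Fin 2 → ℕ) → Fin 9 → List (Edge (HV 2))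
twoHexagonEdges k i = TwoHexagonShape.deleted i (q zero) (p zero) (twoHexagons k)

-- The component Ψ(X | x, B), numbered 8 in the paper.
seven : Fin 9
seven = suc (suc (suc (suc (suc (suc (suc zero))))))

keepColumn : Fin 9 → Mat → Mat
keepColumn j M i l = if does (l ≟ j) then M i l else 0

pair : ℕ → ℕ → Fin 2 → ℕ
pair a b zero = a
pair a b (suc _) = b

twoHexagonTable : ∀ {a b} → Turn a → Turn b → ∀ i σ →
  TwoHexagons.localCount (twoHexagonConstraints (pair a b) i) (twoHexagonEdges (pair a b) i) σ
  ≡ ringMatrix 2 (pair a b) i seven * indicator (class seven σ)
twoHexagonTable {a} {b} ta tb i σ =
  trans (TwoHexagons.localCount-matchings (twoHexagonConstraints (pair a b) i) (twoHexagonEdges (pair a b) i) σ)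
        (table ta tb i σ)
  where
  enumerated expected : ℕ → ℕ → Fin 9 → Signature → ℕ
  enumerated a b i σ = TwoHexagons.localCountByMatchings (twoHexagonConstraints (pair a b) i) (twoHexagonEdges (pair a b) i) σ
  expected a b i σ = ringMatrix 2 (pair a b) i seven * indicator (class seven σ)
  table : ∀ {a b} → Turn a → Turn b → ∀ i σ → enumerated a b i σ ≡ expected a b i σ
  table left left = byComputation (enumerated 1 1) (expected 1 1) refl
  table left straight = byComputation (enumerated 1 2) (expected 1 2) refl
  table left right = byComputation (enumerated 1 3) (expected 1 3) refl
  table straight left = byComputation (enumerated 2 1) (expected 2 1) refl
  table straight straight = byComputation (enumerated 2 2) (expected 2 2) refl
  table straight right = byComputation (enumerated 2 3) (expected 2 3) refl
  table right left = byComputation (enumerated 3 1) (expected 3 1) refl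
  table right straight = byComputation (enumerated 3 2) (expected 3 2) refl
  table right right = byComputation (enumerated 3 3) (expected 3 3) refl

-- The hexagonal chain

embedFirst : ∀ {l} → HV 1 → HV (suc l)
embedFirst (p zero) = p zero
embedFirst (p (suc zero)) = p (suc zero)
embedFirst (q zero) = q zero
embedFirst (q (suc zero)) = q (suc zero)
embedFirst (w zero j) = w zero j

restrictFirst : ∀ {l} → HV (suc l) → HV 1
restrictFirst (p zero) = p zero
restrictFirst (p (suc zero)) = p (suc zero)
restrictFirst (q zero) = q zero
restrictFirst (q (suc zero)) = q (suc zero)
restrictFirst (w zero j) = w zero j
restrictFirst _ = p zero

restrictFirst∘embedFirst : ∀ {l} (u : HV 1) → restrictFirst {l} (embedFirst u) ≡ u
restrictFirst∘embedFirst (p zero) = refl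
restrictFirst∘embedFirst (p (suc zero)) = refl
restrictFirst∘embedFirst (q zero) = refl
restrictFirst∘embedFirst (q (suc zero)) = refl
restrictFirst∘embedFirst (w zero j) = refl

embedFirst-injective : ∀ {l} {u v : HV 1} → embedFirst {l} u ≡ embedFirst v → u ≡ v
embedFirst-injective {l} {u} {v} e =
  trans (sym (restrictFirst∘embedFirst {l} u)) (trans (cong restrictFirst e) (restrictFirst∘embedFirst v))

shiftRest : ∀ {l} → HV l → HV (suc l)
shiftRest (p j) = p (suc j)
shiftRest (q j) = q (suc j)
shiftRest (w i j) = w (suc i) j

shiftRest-injective : ∀ {l} {u v : HV l} → shiftRest u ≡ shiftRest v → u ≡ v
shiftRest-injective {u = p _} {p _} refl = refl
shiftRest-injective {u = q _} {q _} refl = refl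
shiftRest-injective {u = w _ _} {w _ _} refl = refl
shiftRest-injective {u = p _} {q _} ()
shiftRest-injective {u = p _} {w _ _} ()
shiftRest-injective {u = q _} {p _} ()
shiftRest-injective {u = q _} {w _ _} ()
shiftRest-injective {u = w _ _} {p _} ()
shiftRest-injective {u = w _ _} {q _} ()

hexagonIndex : ∀ {l} → HV l → ℕ
hexagonIndex (p j) = toℕ j
hexagonIndex (q j) = toℕ j
hexagonIndex (w i _) = toℕ i

hexagonIndex-shiftRest : ∀ {l} (v : HV l) → hexagonIndex (shiftRest v) ≡ suc (hexagonIndex v)
hexagonIndex-shiftRest (p j) = refl
hexagonIndex-shiftRest (q j) = refl
hexagonIndex-shiftRest (w i j) = refl

embedFirst≢shiftRest : ∀ {l} u (v : HV l) → hexagonIndex u ≡ 0 → embedFirst u ≢ shiftRest v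
embedFirst≢shiftRest (p zero) v _ e with () ← trans (cong hexagonIndex e) (hexagonIndex-shiftRest v)
embedFirst≢shiftRest (q zero) v _ e with () ← trans (cong hexagonIndex e) (hexagonIndex-shiftRest v)
embedFirst≢shiftRest (w zero j) v _ e with () ← trans (cong hexagonIndex e) (hexagonIndex-shiftRest v)

embedFirst≢shiftRest² : ∀ {l} u (v : HV l) → embedFirst u ≢ shiftRest (shiftRest v)
embedFirst≢shiftRest² (p zero) v = embedFirst≢shiftRest (p zero) (shiftRest v) refl
embedFirst≢shiftRest² (q zero) v = embedFirst≢shiftRest (q zero) (shiftRest v) refl
embedFirst≢shiftRest² (w zero j) v = embedFirst≢shiftRest (w zero j) (shiftRest v) refl
embedFirst≢shiftRest² (p (suc zero)) v e = embedFirst≢shiftRest (p zero) v refl (shiftRest-injective {u = p zero} e)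
embedFirst≢shiftRest² (q (suc zero)) v e = embedFirst≢shiftRest (q zero) v refl (shiftRest-injective {u = q zero} e)

private⇒first : ∀ u → Hexagon.isPrivate u ≡ true → hexagonIndex u ≡ 0
private⇒first (p zero) _ = refl
private⇒first (q zero) _ = refl
private⇒first (w zero j) _ = refl
private⇒first (p (suc zero)) ()
private⇒first (q (suc zero)) ()

pathEdges-map : (f : A → B) (xs : List A) → pathEdges (map f xs) ≡ mapEdges f (pathEdges xs)
pathEdges-map f [] = refl
pathEdges-map f (x ∷ []) = refl
pathEdges-map f (x ∷ y ∷ xs) = cong ((f x , f y) ∷_) (pathEdges-map f (y ∷ xs))

rungs : ∀ n → List (Edge (HV n))
rungs n = map (λ j → (p j , q j)) (allFin (suc n))

rungs-suc : ∀ l → rungs (suc l) ≡ (p zero , q zero) ∷ mapEdges shiftRest (rungs l)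
rungs-suc l = cong ((p zero , q zero) ∷_)
  (trans (List.map-tabulate suc (λ j → (p j , q j)))
    (sym (trans (cong (mapEdges shiftRest) (List.map-tabulate (λ j → j) (λ j → (p j , q j))))
                (List.map-tabulate (λ j → (p j , q j)) (mapEdge shiftRest)))))

module _ {l : ℕ} (k : Fin (suc l) → ℕ) where

  qPath-shift : ∀ i → map shiftRest (qPath (k ∘ suc) i) ≡ qPath k (suc i)
  qPath-shift i = cong (q (suc (inject₁ i)) ∷_) (trans (List.map-++ shiftRest (Xs (k ∘ suc) i) (q (suc i) ∷ []))
    (cong (_++ (q (suc (suc i)) ∷ [])) (sym (List.take-map (k (suc i) ∸ 1) (inner (k ∘ suc) i)))))

  pPath-shift : ∀ i → map shiftRest (pPath (k ∘ suc) i) ≡ pPath k (suc i)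
  pPath-shift i = cong (p (suc (suc i)) ∷_) (trans (List.map-++ shiftRest (Ys (k ∘ suc) i) (p (inject₁ i) ∷ []))
    (cong (_++ (p (suc (inject₁ i)) ∷ [])) (sym (List.drop-map (k (suc i) ∸ 1) (inner (k ∘ suc) i)))))

  hexagonSides-shift : ∀ i → mapEdges shiftRest (hexagonSides (k ∘ suc) i) ≡ hexagonSides k (suc i)
  hexagonSides-shift i = trans (List.map-++ (mapEdge shiftRest) (pathEdges (qPath (k ∘ suc) i)) _)
    (cong₂ _++_ (trans (sym (pathEdges-map shiftRest (qPath (k ∘ suc) i))) (cong pathEdges (qPath-shift i)))
                (trans (sym (pathEdges-map shiftRest (pPath (k ∘ suc) i))) (cong pathEdges (pPath-shift i))))

  sides-suc : sides (suc l) k ≡ hexagonSides k zero ++ mapEdges shiftRest (sides l (k ∘ suc))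
  sides-suc = cong (hexagonSides k zero ++_)
    (trans (cong concat (List.map-tabulate suc (hexagonSides k)))
      (sym (trans (List.map-concatMap (mapEdge shiftRest) (hexagonSides (k ∘ suc)) (allFin l))
        (trans (List.concatMap-cong hexagonSides-shift (allFin l))
               (cong concat (List.map-tabulate (λ j → j) (hexagonSides k ∘ suc)))))))

  qPath-embed : map embedFirst (qPath (λ _ → k zero) zero) ≡ qPath k zero
  qPath-embed = cong (q zero ∷_) (trans (List.map-++ embedFirst (Xs (λ _ → k zero) zero) (q (suc zero) ∷ []))
    (cong (_++ (q (suc zero) ∷ [])) (sym (List.take-map (k zero ∸ 1) (inner (λ _ → k zero) zero)))))

  pPath-embed : map embedFirst (pPath (λ _ → k zero) zero) ≡ pPath k zero
  pPath-embed = cong (p (suc zero) ∷_) (trans (List.map-++ embedFirst (Ys (λ _ → k zero) zero) (p zero ∷ []))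
    (cong (_++ (p zero ∷ [])) (sym (List.drop-map (k zero ∸ 1) (inner (λ _ → k zero) zero)))))

  openHexagon-embed : mapEdges embedFirst (openHexagon (k zero)) ≡ (p zero , q zero) ∷ hexagonSides k zero
  openHexagon-embed = cong ((p zero , q zero) ∷_)
    (trans (List.map-++ (mapEdge embedFirst) (pathEdges (qPath (λ _ → k zero) zero)) _)
      (cong₂ _++_ (trans (sym (pathEdges-map embedFirst (qPath (λ _ → k zero) zero))) (cong pathEdges qPath-embed))
                  (trans (sym (pathEdges-map embedFirst (pPath (λ _ → k zero) zero))) (cong pathEdges pPath-embed))))

  chainEdges-↭ : chainEdges (suc l) k ↭ mapEdges embedFirst (openHexagon (k zero)) ++ mapEdges shiftRest (chainEdges l (k ∘ suc))
  chainEdges-↭ = subst₂ _↭_ (sym split) (sym regroup) (↭.prep (p zero , q zero) (↭.shifts Rs S₀ {Ss}))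
    where
    Rs Ss : List (Edge (HV (suc l)))
    Rs = mapEdges shiftRest (rungs l)
    S₀ : List (Edge (HV (suc l)))
    S₀ = hexagonSides k zero
    Ss = mapEdges shiftRest (sides l (k ∘ suc))
    split : chainEdges (suc l) k ≡ (p zero , q zero) ∷ (Rs ++ (S₀ ++ Ss))
    split = cong₂ _++_ (rungs-suc l) sides-suc
    regroup : mapEdges embedFirst (openHexagon (k zero)) ++ mapEdges shiftRest (chainEdges l (k ∘ suc))
            ≡ (p zero , q zero) ∷ (S₀ ++ (Rs ++ Ss))
    regroup = trans (cong₂ _++_ openHexagon-embed (List.map-++ (mapEdge shiftRest) (rungs l) (sides l (k ∘ suc))))
                    (List.++-assoc ((p zero , q zero) ∷ []) S₀ (Rs ++ Ss))

lastOf-map : (f : A → B) (z : A) (xs : List A) → f (lastOf z xs) ≡ lastOf (f z) (map f xs)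
lastOf-map f z [] = refl
lastOf-map f z (y ∷ ys) = lastOf-map f y ys

headOr-map : (f : A → B) (z : A) (xs : List A) → f (headOr z xs) ≡ headOr (f z) (map f xs)
headOr-map f z [] = refl
headOr-map f z (y ∷ ys) = refl

vE-shift : ∀ l (k : Fin (2 + l) → ℕ) → vE (2 + l) k ≡ shiftRest (vE (1 + l) (k ∘ suc))
vE-shift l k = sym (trans (lastOf-map shiftRest _ (Xs (k ∘ suc) (fromℕ l)))
  (cong (lastOf _) (sym (List.take-map (k (fromℕ (1 + l)) ∸ 1) (inner (k ∘ suc) (fromℕ l))))))

vF-shift : ∀ l (k : Fin (2 + l) → ℕ) → vF (2 + l) k ≡ shiftRest (vF (1 + l) (k ∘ suc))
vF-shift l k = sym (trans (headOr-map shiftRest _ (Ys (k ∘ suc) (fromℕ l)))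
  (cong (headOr _) (sym (List.drop-map (k (fromℕ (1 + l)) ∸ 1) (inner (k ∘ suc) (fromℕ l))))))

module Chain {V : Set} (_≟_ : DecidableEquality V) where
  open Matching _≟_
  open MatchingFacts _≟_
  open Permutation _≟_
  private
    module HVeq {l : ℕ} = Matching (_≟HV_ {l})

  lastEdge : ∀ {l} → (HV l → V) → Edge V
  lastEdge {l} ρ = ρ (p (fromℕ l)) , ρ (q (fromℕ l))

  -- Ψ(K | d) for K = dc ∷ Rest.
  closingCount : ∀ {l} → (HV l → V) → List (Edge V) → ℕ
  closingCount {l} ρ Rest = Ψ (cons [] [] (ρ (q (fromℕ l)) ∷ []) []) (lastEdge ρ ∷ Rest)

  NotAtEnd : ∀ {l} → HV l → Set
  NotAtEnd {l} u = (u HVeq.== q (fromℕ l)) ≡ false × (u HVeq.== p (fromℕ l)) ≡ false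

  AttachedAtEnd : ∀ {l} → (HV l → V) → List (Edge V) → Set
  AttachedAtEnd ρ Rest = All (λ e → ∀ u → NotAtEnd u → incident (ρ u) e ≡ false) Rest

  Injective : ∀ {l} → (HV l → V) → Set
  Injective ρ = ∀ {u v} → ρ u ≡ ρ v → u ≡ v

  module TwoHexagonBase (ρ : HV 2 → V) (ρ-injective : Injective ρ) (Rest : List (Edge V))
                        (attached : AttachedAtEnd ρ Rest) where
    open Gluing _≟_ (_≟HV_ {2}) ρ ρ-injective (q (suc (suc zero))) (p (suc (suc zero))) refl (lastEdge ρ ∷ Rest)
    private
      module Rρ = Renaming _≟HV_ _≟_ ρ ρ-injective
      module HVF = MatchingFacts (_≟HV_ {2})

    fresh : All FreshEdge (lastEdge ρ ∷ Rest)
    fresh = lastEdge-fresh ∷ All.map (λ h u pu → h u (not-at-end u pu)) attached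
      where
      not-at-end : ∀ u → isPrivate u ≡ true → NotAtEnd u
      not-at-end u pu = not-∧-not (u HVeq.== q (fromℕ 2)) (u HVeq.== p (fromℕ 2)) pu
      lastEdge-fresh : FreshEdge (lastEdge ρ)
      lastEdge-fresh u pu = trans (Rρ.incident-rename u (p (fromℕ 2) , q (fromℕ 2))) (cong₂ _∨_
        (trans (HVF.==-sym (p (fromℕ 2)) u) (proj₂ (not-at-end u pu)))
        (trans (HVF.==-sym (q (fromℕ 2)) u) (proj₁ (not-at-end u pu))))

    private-edges : ∀ {a b} → Turn b → PrivateEdges (lastConstraints (pair a b))
    private-edges left = (refl ∷ refl ∷ []) , []
    private-edges straight = (refl ∷ refl ∷ []) , []
    private-edges right = (refl ∷ refl ∷ []) , []

    base : ∀ {a b} → Turn a → Turn b → ∀ i →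
      Ψvec (mapConstraints ρ (lastConstraints (pair a b))) (mapEdges ρ (twoHexagons (pair a b)) ++ (lastEdge ρ ∷ Rest))
           (ρ (q zero)) (ρ (p zero)) i
        ≡ ringMatrix 2 (pair a b) i seven * closingCount ρ Rest
    base {a} {b} ta tb i = trans
      (transfer-Ψvec (lastConstraints (pair a b)) noConstraints (twoHexagons (pair a b)) (q zero) (p zero)
         (keepColumn seven (ringMatrix 2 (pair a b))) refl refl fresh (private-edges {a} tb) ([] , [] , [] , []) table i)
      (+-identityʳ _)
      where
      table : ∀ i σ → localCount (twoHexagonConstraints (pair a b) i) (twoHexagonEdges (pair a b) i) σ
        ≡ sumFin 9 (λ l → keepColumn seven (ringMatrix 2 (pair a b)) i l * indicator (class l σ))
      table i σ = trans (twoHexagonTable ta tb i σ) (sym (+-identityʳ _))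

  module FirstHexagon {l : ℕ} (ρ : HV (3 + l) → V) (ρ-injective : Injective ρ) (k : Fin (3 + l) → ℕ)
                      (Rest : List (Edge V)) where
    ι : HV 1 → V
    ι u = ρ (embedFirst u)

    ρ' : HV (2 + l) → V
    ρ' u = ρ (shiftRest u)

    ρ'-injective : Injective ρ'
    ρ'-injective e = shiftRest-injective (ρ-injective e)

    R' : List (Edge V)
    R' = mapEdges ρ' (chainEdges (2 + l) (k ∘ suc)) ++ Rest

    module H = Gluing _≟_ (_≟HV_ {1}) ι (λ e → embedFirst-injective (ρ-injective e)) (q (suc zero)) (p (suc zero)) refl R'
    private
      module Rρ = Renaming _≟HV_ _≟_ ρ ρ-injective
      module Rshift = Renaming (_≟HV_ {2 + l}) _≟HV_ shiftRest shiftRest-injective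
      module HVF = MatchingFacts (_≟HV_ {3 + l})

    chain-↭ : mapEdges ρ (chainEdges (3 + l) k) ++ Rest ↭ mapEdges ι (openHexagon (k zero)) ++ R'
    chain-↭ = ↭.trans (↭.++⁺ʳ Rest (↭.map⁺ (mapEdge ρ) (chainEdges-↭ k))) (↭.↭-reflexive (begin
      mapEdges ρ (mapEdges embedFirst O ++ mapEdges shiftRest C') ++ Rest
        ≡⟨ cong (_++ Rest) (List.map-++ (mapEdge ρ) (mapEdges embedFirst O) _) ⟩
      (mapEdges ρ (mapEdges embedFirst O) ++ mapEdges ρ (mapEdges shiftRest C')) ++ Rest
        ≡⟨ List.++-assoc (mapEdges ρ (mapEdges embedFirst O)) _ Rest ⟩
      mapEdges ρ (mapEdges embedFirst O) ++ (mapEdges ρ (mapEdges shiftRest C') ++ Rest)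
        ≡⟨ cong₂ (λ A B → A ++ (B ++ Rest)) (sym (List.map-∘ O)) (sym (List.map-∘ C')) ⟩
      mapEdges ι O ++ R' ∎))
      where
      open ≡-Reasoning
      O : List (Edge (HV 1))
      O = openHexagon (k zero)
      C' : List (Edge (HV (2 + l)))
      C' = chainEdges (2 + l) (k ∘ suc)

    rest-fresh : AttachedAtEnd ρ Rest → All H.FreshEdge R'
    rest-fresh attached = All.++⁺ (All.map⁺ (All.universal chain-fresh (chainEdges (2 + l) (k ∘ suc))))
                                  (All.map (λ h u pu → h (embedFirst u) (far-from-end u)) attached)
      where
      apart : ∀ u v → H.isPrivate u ≡ true → (shiftRest v HVeq.== embedFirst u) ≡ false
      apart u v pu = HVF.==-≢ (λ e → embedFirst≢shiftRest u v (private⇒first u pu) (sym e))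
      chain-fresh : ∀ e → H.FreshEdge (mapEdge ρ' e)
      chain-fresh (a , b) u pu =
        trans (Rρ.incident-rename (embedFirst u) (shiftRest a , shiftRest b)) (cong₂ _∨_ (apart u a pu) (apart u b pu))
      far-from-end : ∀ u → NotAtEnd (embedFirst {2 + l} u)
      far-from-end u = HVF.==-≢ (embedFirst≢shiftRest² u (q (fromℕ (1 + l))))
                     , HVF.==-≢ (embedFirst≢shiftRest² u (p (fromℕ (1 + l))))

    constraints-far : H.FarConstraints (mapConstraints ρ (lastConstraints k))
    constraints-far = (far-vE ∷ []) , (far-vE ∷ far-vF ∷ []) , (far-vF ∷ []) , []
      where
      far-shift² : ∀ z v → z ≡ shiftRest (shiftRest v) → H.Far (ρ z)
      far-shift² z v z≡ u = trans (Rρ.==-rename (embedFirst u) z) (HVF.==-≢ (λ e → embedFirst≢shiftRest² u v (trans e z≡)))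
      far-vE : H.Far (ρ (vE (3 + l) k))
      far-vE = far-shift² _ _ (trans (vE-shift (1 + l) k) (cong shiftRest (vE-shift l (k ∘ suc))))
      far-vF : H.Far (ρ (vF (3 + l) k))
      far-vF = far-shift² _ _ (trans (vF-shift (1 + l) k) (cong shiftRest (vF-shift l (k ∘ suc))))

    constraints-shift : mapConstraints ρ (lastConstraints k) ≡ mapConstraints ρ' (lastConstraints (k ∘ suc))
    constraints-shift = cong₂ (λ e f → cons (ρ e ∷ []) ((ρ e , ρ (vD (3 + l))) ∷ (ρ f , ρ (vC (3 + l))) ∷ []) (ρ f ∷ []) [])
                              (vE-shift (1 + l) k) (vF-shift (1 + l) k)

    attached-shift : AttachedAtEnd ρ Rest → AttachedAtEnd ρ' Rest
    attached-shift = All.map (λ h u (u≢d , u≢c) → h (shiftRest u)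
      (trans (Rshift.==-rename u (q (fromℕ (2 + l)))) u≢d , trans (Rshift.==-rename u (p (fromℕ (2 + l)))) u≢c))

  chainTransfer : ∀ l (ρ : HV (2 + l) → V) → Injective ρ → (k : Fin (2 + l) → ℕ) → (∀ i → Turn (k i))
    → (Rest : List (Edge V)) → AttachedAtEnd ρ Rest → ∀ i
    → Ψvec (mapConstraints ρ (lastConstraints k)) (mapEdges ρ (chainEdges (2 + l) k) ++ Rest) (ρ (q zero)) (ρ (p zero)) i
      ≡ ringMatrix (2 + l) k i seven * closingCount ρ Rest
  chainTransfer zero ρ ρ-injective k turns Rest attached i =
    trans (Ψvec-↭ (mapConstraints ρ (lastConstraints k)) (ρ (q zero)) (ρ (p zero)) i reorder)
          (TwoHexagonBase.base ρ ρ-injective Rest attached (turns zero) (turns (suc zero)) i)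
    where
    reorder : mapEdges ρ (chainEdges 2 k) ++ Rest ↭ mapEdges ρ (twoHexagons k) ++ (lastEdge ρ ∷ Rest)
    reorder = ↭.prep _ (↭.prep _ (↭.↭-sym (↭.shift (lastEdge ρ) (mapEdges ρ (sides 2 k)) Rest)))
  chainTransfer (suc l) ρ ρ-injective k turns Rest attached i = begin
    Ψvec C (mapEdges ρ (chainEdges (3 + l) k) ++ Rest) (ρ (q zero)) (ρ (p zero)) i
      ≡⟨ Ψvec-↭ C (ρ (q zero)) (ρ (p zero)) i chain-↭ ⟩
    Ψvec C (mapEdges ι (openHexagon (k zero)) ++ R') (ι (q zero)) (ι (p zero)) i
      ≡⟨ H.transfer-Ψvec noConstraints C (openHexagon (k zero)) (q zero) (p zero) (kMat (k zero))
           refl refl (rest-fresh attached) ([] , []) constraints-far (hexagonTable (turns zero)) i ⟩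
    sumFin 9 (λ j → kMat (k zero) i j * Ψvec C R' (ρ' (q zero)) (ρ' (p zero)) j)
      ≡⟨ sumFin-cong 9 (λ j → cong (kMat (k zero) i j *_) (trans
           (cong (λ C → Ψvec C R' (ρ' (q zero)) (ρ' (p zero)) j) constraints-shift)
           (chainTransfer l ρ' ρ'-injective (k ∘ suc) (turns ∘ suc) Rest (attached-shift attached) j))) ⟩
    sumFin 9 (λ j → kMat (k zero) i j * (ringMatrix (2 + l) (k ∘ suc) j seven * closingCount ρ Rest))
      ≡⟨ sumFin-*-assoc 9 (kMat (k zero) i) (λ j → ringMatrix (2 + l) (k ∘ suc) j seven) (closingCount ρ Rest) ⟩
    ringMatrix (3 + l) k i seven * closingCount ρ Rest ∎
    where
    open FirstHexagon ρ ρ-injective k Rest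
    open ≡-Reasoning
    C : Constraints V
    C = mapConstraints ρ (lastConstraints k)

-- Attaching K

AllPairs-split : {R : A → A → Set} (pre : List A) {e : A} {post : List A}
  → AllPairs R (pre ++ e ∷ post) → All (λ x → R x e) pre × All (R e) post
AllPairs-split [] (Re ∷ _) = [] , Re
AllPairs-split (x ∷ pre) (Rx ∷ Rs) =
  (All.head (All.++⁻ʳ pre Rx) ∷ proj₁ (AllPairs-split pre Rs)) , proj₂ (AllPairs-split pre Rs)

dc : ∀ {m} → Edge (Fin (suc (suc m)))
dc = zero , suc zero

≈ₑ-sym : {e e' : Edge A} → e ≈ₑ e' → e' ≈ₑ e
≈ₑ-sym (inj₁ (refl , refl)) = inj₁ (refl , refl)
≈ₑ-sym (inj₂ (refl , refl)) = inj₂ (refl , refl)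

≈ₑ-trans-dc : ∀ {m} {e e' : Edge (Fin (suc (suc m)))} → e ≈ₑ dc → e' ≈ₑ dc → e ≈ₑ e'
≈ₑ-trans-dc (inj₁ (refl , refl)) (inj₁ (refl , refl)) = inj₁ (refl , refl)
≈ₑ-trans-dc (inj₁ (refl , refl)) (inj₂ (refl , refl)) = inj₂ (refl , refl)
≈ₑ-trans-dc (inj₂ (refl , refl)) (inj₁ (refl , refl)) = inj₂ (refl , refl)
≈ₑ-trans-dc (inj₂ (refl , refl)) (inj₂ (refl , refl)) = inj₁ (refl , refl)

unembedK : ∀ {n m} → FV n m → Fin (suc (suc m))
unembedK (inj₁ (p _)) = suc zero
unembedK (inj₁ _) = zero
unembedK (inj₂ j) = suc (suc j)

embedK-injective : ∀ n {m} {a b : Fin (suc (suc m))} → embedK n a ≡ embedK n b → a ≡ b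
embedK-injective n {m} {a} {b} e = trans (sym (retract a)) (trans (cong unembedK e) (retract b))
  where
  retract : ∀ a → unembedK (embedK n {m} a) ≡ a
  retract zero = refl
  retract (suc zero) = refl
  retract (suc (suc j)) = refl

module Closing (n' m : ℕ) (k : Fin (3 + n') → ℕ) where
  n : ℕ
  n = 3 + n'
  open Matching (_≟F_ {n} {m})
  open Permutation (_≟F_ {n} {m})
  open Chain (_≟F_ {n} {m})
  private
    module K = Matching (_≟_ {suc (suc m)})
    module KR = Reversal (_≟_ {suc (suc m)})
    module FU = Union (_≟F_ {n} {m})
    module RK = Renaming (_≟_ {suc (suc m)}) (_≟F_ {n} {m}) (embedK n) (embedK-injective n)
    module HVF = MatchingFacts (_≟HV_ {n})
    module FF = MatchingFacts (_≟F_ {n} {m})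

  embed : Edge (Fin (suc (suc m))) → Edge (FV n m)
  embed = mapEdge (embedK n)

  chainF : List (Edge (FV n m))
  chainF = mapEdges inj₁ (chainEdges n k)

  embedded-not-in-chain : ∀ a b → a ≢ b → ¬ ((a , b) ≈ₑ dc) → memE (embed (a , b)) chainF ≡ false
  embedded-not-in-chain (suc (suc j)) b _ _ =
    trans (anyᵇ-map (sameEdge (embed (suc (suc j) , b))) (mapEdge inj₁) (chainEdges n k)) (anyᵇ-false _ (chainEdges n k) (λ _ → refl))
  embedded-not-in-chain zero (suc (suc j)) _ _ =
    trans (anyᵇ-map (sameEdge (embed (zero , suc (suc j)))) (mapEdge inj₁) (chainEdges n k))
          (anyᵇ-false _ (chainEdges n k) (λ { (u , v) →
            cong₂ _∨_ (∧-zeroʳ (embedK n zero == inj₁ u)) (∧-zeroʳ (embedK n zero == inj₁ v)) }))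
  embedded-not-in-chain (suc zero) (suc (suc j)) _ _ =
    trans (anyᵇ-map (sameEdge (embed (suc zero , suc (suc j)))) (mapEdge inj₁) (chainEdges n k))
          (anyᵇ-false _ (chainEdges n k) (λ { (u , v) →
            cong₂ _∨_ (∧-zeroʳ (embedK n (suc zero) == inj₁ u)) (∧-zeroʳ (embedK n (suc zero) == inj₁ v)) }))
  embedded-not-in-chain zero zero a≢b _ = ⊥-elim (a≢b refl)
  embedded-not-in-chain (suc zero) (suc zero) a≢b _ = ⊥-elim (a≢b refl)
  embedded-not-in-chain zero (suc zero) _ not-dc = ⊥-elim (not-dc (inj₁ (refl , refl)))
  embedded-not-in-chain (suc zero) zero _ not-dc = ⊥-elim (not-dc (inj₂ (refl , refl)))

  others-not-in-chain : ∀ {e₀} → e₀ ≈ₑ dc → ∀ {xs} → All (λ { (u , v) → u ≢ v }) xs → All (λ x → ¬ (x ≈ₑ e₀)) xs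
    → All (λ e → memE e chainF ≡ false) (map embed xs)
  others-not-in-chain e₀≈dc [] [] = []
  others-not-in-chain e₀≈dc {(a , b) ∷ xs} (a≢b ∷ loopless) (x≉e₀ ∷ distinct) =
    embedded-not-in-chain a b a≢b (λ x≈dc → x≉e₀ (≈ₑ-trans-dc x≈dc e₀≈dc)) ∷ others-not-in-chain e₀≈dc loopless distinct

  dc-in-chain : ∀ e₀ → e₀ ≈ₑ dc → memE (embed e₀) chainF ≡ true
  dc-in-chain e₀ e₀≈dc = anyᵇ-∈ (sameEdge (embed e₀)) lastEdge∈chain (same e₀ e₀≈dc)
    where
    lastEdge∈chain : lastEdge {n} inj₁ ∈ chainF
    lastEdge∈chain = ∈-map⁺ (mapEdge inj₁) (∈-++⁺ˡ (∈-map⁺ (λ j → (p j , q j)) (∈-allFin (fromℕ n))))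
    same : ∀ e₀ → e₀ ≈ₑ dc → sameEdge (embed e₀) (lastEdge inj₁) ≡ true
    same _ (inj₁ (refl , refl)) rewrite FF.==-refl (inj₁ (q (fromℕ n))) | FF.==-refl (inj₁ (p (fromℕ n))) =
      ∨-zeroʳ ((inj₁ (q (fromℕ n)) == inj₁ (p (fromℕ n))) ∧ (inj₁ (p (fromℕ n)) == inj₁ (q (fromℕ n))))
    same _ (inj₂ (refl , refl)) rewrite FF.==-refl (inj₁ (q (fromℕ n))) | FF.==-refl (inj₁ (p (fromℕ n))) = refl

  attached : ∀ KE → AttachedAtEnd inj₁ (map embed KE)
  attached KE = All.map⁺ (All.universal (λ { (a , b) u u∉end → cong₂ _∨_ (apart a u u∉end) (apart b u u∉end) }) KE)
    where
    apart : ∀ j u → NotAtEnd u → (embedK n j == inj₁ u) ≡ false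
    apart zero u (u≢d , _) = trans (HVF.==-sym (q (fromℕ n)) u) u≢d
    apart (suc zero) u (_ , u≢c) = trans (HVF.==-sym (p (fromℕ n)) u) u≢c
    apart (suc (suc j)) u _ = refl

  closingCount≡ΨK : ∀ pre e₀ post → e₀ ≈ₑ dc
    → closingCount inj₁ (map embed pre ++ map embed post) ≡ K.Ψ (cons [] [] (zero ∷ []) []) (pre ++ e₀ ∷ post)
  closingCount≡ΨK pre e₀ post e₀≈dc = begin
    Ψ (mapConstraints (embedK n) C₀) (lastEdge inj₁ ∷ map embed pre ++ map embed post)
      ≡⟨ Ψ-↭ (mapConstraints (embedK n) C₀) (↭.↭-sym (↭.shift (lastEdge inj₁) (map embed pre) (map embed post))) ⟩
    Ψ (mapConstraints (embedK n) C₀) (map embed pre ++ embed (suc zero , zero) ∷ map embed post)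
      ≡⟨ cong (Ψ (mapConstraints (embedK n) C₀)) (sym (List.map-++ embed pre ((suc zero , zero) ∷ post))) ⟩
    Ψ (mapConstraints (embedK n) C₀) (mapEdges (embedK n) (pre ++ (suc zero , zero) ∷ post))
      ≡⟨ RK.Ψ-rename C₀ (pre ++ (suc zero , zero) ∷ post) ⟩
    K.Ψ C₀ (pre ++ (suc zero , zero) ∷ post)
      ≡⟨ orient e₀ e₀≈dc ⟩
    K.Ψ C₀ (pre ++ e₀ ∷ post) ∎
    where
    open ≡-Reasoning
    C₀ : Constraints (Fin (suc (suc m)))
    C₀ = cons [] [] (zero ∷ []) []
    orient : ∀ e₀ → e₀ ≈ₑ dc → K.Ψ C₀ (pre ++ (suc zero , zero) ∷ post) ≡ K.Ψ C₀ (pre ++ e₀ ∷ post)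
    orient _ (inj₁ (refl , refl)) = KR.Ψ-swap-middle C₀ pre (suc zero) zero post
    orient _ (inj₂ (refl , refl)) = refl

  FEdges-decompose : ∀ pre e₀ post → e₀ ≈ₑ dc → SimpleEdges (pre ++ e₀ ∷ post)
    → FEdges n k m (pre ++ e₀ ∷ post) ≡ chainF ++ (map embed pre ++ map embed post)
  FEdges-decompose pre e₀ post e₀≈dc (loopless , distinct)
    with All.++⁻ pre loopless | AllPairs-split pre distinct
  ... | loopless-pre , _ ∷ loopless-post | distinct-pre , distinct-post = begin
    union chainF (map embed (pre ++ e₀ ∷ post))
      ≡⟨ FU.union≡++dedup chainF (map embed (pre ++ e₀ ∷ post)) ⟩
    chainF ++ FU.dedup chainF (map embed (pre ++ e₀ ∷ post))
      ≡⟨ cong (λ E → chainF ++ FU.dedup chainF E) (List.map-++ embed pre (e₀ ∷ post)) ⟩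
    chainF ++ FU.dedup chainF (map embed pre ++ embed e₀ ∷ map embed post)
      ≡⟨ cong (chainF ++_) (FU.dedup-middle chainF _ _ _ (dc-in-chain e₀ e₀≈dc)
           (others-not-in-chain e₀≈dc loopless-pre distinct-pre)
           (others-not-in-chain e₀≈dc loopless-post (All.map (λ e₀≉x x≈e₀ → e₀≉x (≈ₑ-sym x≈e₀)) distinct-post))) ⟩
    chainF ++ (map embed pre ++ map embed post) ∎
    where open ≡-Reasoning

lemma8 : (n : ℕ) → 3 ≤ n → (k : Fin n → ℕ) → (∀ i → 1 ≤ k i × k i ≤ 3)
    → (m : ℕ) → (KE : List (Edge (Fin (suc (suc m)))))
    → SimpleEdges KE → Any (λ e → e ≈ₑ (zero , suc zero)) KE
    → ∀ (i : Fin 9)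
    → Matching.Ψvec _≟F_
        (cons (inj₁ (vE n k) ∷ [])
              ((inj₁ (vE n k) , inj₁ (vD n)) ∷ (inj₁ (vF n k) , inj₁ (vC n)) ∷ [])
              (inj₁ (vF n k) ∷ [])
              [])
        (FEdges n k m KE) (inj₁ (vA n)) (inj₁ (vB n)) i
      ≡ ringMatrix n k i (suc (suc (suc (suc (suc (suc (suc zero)))))))
        * Matching.Ψ _≟_ (cons [] [] (zero ∷ []) []) KE
lemma8 (suc (suc (suc n'))) (s≤s (s≤s (s≤s _))) k bounds m KE simple dc∈KE i
  with find dc∈KE
... | e₀ , e₀∈KE , e₀≈dc with ∈-∃++ e₀∈KE
... | pre , post , refl = begin
  Ψvec C (FEdges n k m (pre ++ e₀ ∷ post)) (inj₁ (q zero)) (inj₁ (p zero)) i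
    ≡⟨ cong (λ E → Ψvec C E (inj₁ (q zero)) (inj₁ (p zero)) i) (FEdges-decompose pre e₀ post e₀≈dc simple) ⟩
  Ψvec C (mapEdges inj₁ (chainEdges n k) ++ Rest) (inj₁ (q zero)) (inj₁ (p zero)) i
    ≡⟨ chainTransfer (suc n') inj₁ inj₁-injective k (λ j → toTurn (k j) (bounds j)) Rest
         (All.++⁺ (attached pre) (attached post)) i ⟩
  ringMatrix n k i seven * closingCount inj₁ Rest
    ≡⟨ cong (ringMatrix n k i seven *_) (closingCount≡ΨK pre e₀ post e₀≈dc) ⟩
  ringMatrix n k i seven * Matching.Ψ _≟_ (cons [] [] (zero ∷ []) []) (pre ++ e₀ ∷ post) ∎
  where
  open Closing n' m k
  open Matching (_≟F_ {n} {m})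
  open Chain (_≟F_ {n} {m})
  open ≡-Reasoning
  C : Constraints (FV n m)
  C = mapConstraints inj₁ (lastConstraints k)
  Rest : List (Edge (FV n m))
  Rest = map embed pre ++ map embed post
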